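{- Let $G$ be a $2$-connected graph, let $u$ and $v$ be vertices of $G$, and let $\mathcal{C}$ be a set of cycles of $G$. If $\mathcal{C}$ is $\Delta^*$-dense, then $\mathcal{P}_{\mathcal{C}}(G_{uv})$ is connected.
   Context: For a path $L$ and vertices $x,y$ on $L$, $L_{xy}$ denotes the subpath of $L$ joining $x$ and $y$. For vertices $u,v$ of a $2$-connected graph $G$, the $uv$ path graph $\mathcal{P}(G_{uv})$ has as vertices the paths in $G$ joining $u$ and $v$, where two such paths $S$ and $T$ are adjacent if $T$ is obtained from $S$ by replacing a subpath $S_{xy}$ of $S$ with a subpath $T_{xy}$ of $T$ internally disjoint from $S_{xy}$; in that case $S\cup T$ contains a unique cycle, namely $S\Delta T$ (where $F\Delta H$ is the subgraph induced by the edges in exactly one of $F,H$). For a set $\mathcal{C}$ of cycles of $G$, $\mathcal{P}_\mathcal{C}(G_{uv})$ is the spanning subgraph of $\mathcal{P}(G_{uv})$ in which adjacent paths $S,T$ remain adjacent if and only if the unique cycle contained in $S\cup T$ belongs to $\mathcal{C}$. A unicycle of $G$ is a spanning subgraph of $G$ containing a unique cycle. A cycle $\sigma$ of $G$ has Property $\Delta^*$ with respect to a set of cycles $\mathcal{D}$ if for every unicycle $\mathcal{U}$ containing $\sigma$ there exist an edge $e$ of $G$ not in $\mathcal{U}$ and two cycles $\alpha,\beta\in\mathcal{D}$, both contained in $\mathcal{U}+e$, with $\sigma=\alpha\Delta\beta$. The closure $Cl(\mathcal{C})$ is obtained by setting $\mathcal{C}_0=\mathcal{C}$ and, as long as some cycle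 $\sigma_{t+1}\notin\mathcal{C}_t$ has Property $\Delta^*$ with respect to $\mathcal{C}_t$, setting $\mathcal{C}_{t+1}=\mathcal{C}_t\cup\{\sigma_{t+1}\}$; $Cl(\mathcal{C})$ is the final set $\mathcal{C}_k$ when no such cycle exists (this final set is known not to depend on the choices made). $\mathcal{C}$ is $\Delta^*$-dense if $Cl(\mathcal{C})$ is the set of all cycles of $G$. -}

module Defs where

open import Data.Nat using (ℕ; _≤_)
open import Data.Fin using (Fin)
open import Data.Fin.Subset using (Subset; _∈_; _∉_; _⊆_; _∪_; ⁅_⁆)
open import Data.Bool using (_xor_)
open import Data.Vec using (zipWith)
open import Data.List using (List; []; _∷_; _++_; head; last; length)
import Data.List.Membership.Propositional as L
open import Data.List.Relation.Unary.Unique.Propositional using (Unique)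
open import Data.Maybe using (just)
open import Data.Product using (Σ; ∃; _×_; _,_; proj₁; proj₂)
open import Data.Sum using (_⊎_)
open import Data.Unit using (⊤)
open import Data.Empty using (⊥)
open import Relation.Nullary using (¬_)
open import Relation.Binary.PropositionalEquality using (_≡_; _≢_)
open import Relation.Binary.Construct.Closure.ReflexiveTransitive using (Star)
open import Function.Bundles using (_⇔_)

record Graph : Set where
  field
    n    : ℕ
    m    : ℕ
    ends : Fin m → Fin n × Fin n

  Joins : Fin m → Fin n → Fin n → Set
  Joins e x y = ends e ≡ (x , y) ⊎ ends e ≡ (y , x)

  field
    loopless : ∀ e → proj₁ (ends e) ≢ proj₂ (ends e)
    simple   : ∀ e f x y → Joins e x y → Joins f x y → e ≡ f

  -- A subgraph is identified with its edge set.
  EdgeSet : Set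
  EdgeSet = Subset m

  Adj : Fin n → Fin n → Set
  Adj x y = ∃ λ e → Joins e x y

  Chain : List (Fin n) → Set
  Chain []           = ⊤
  Chain (x ∷ [])     = ⊤
  Chain (x ∷ y ∷ xs) = Adj x y × Chain (y ∷ xs)

  OnList : List (Fin n) → Fin m → Set
  OnList []           e = ⊥
  OnList (x ∷ [])     e = ⊥
  OnList (x ∷ y ∷ xs) e = Joins e x y ⊎ OnList (y ∷ xs) e

  EdgesOf : List (Fin n) → EdgeSet → Set
  EdgesOf xs s = ∀ e → (e ∈ s) ⇔ OnList xs e

  Walk : Fin n → Fin n → List (Fin n) → Set
  Walk a b xs = Chain xs × head xs ≡ just a × last xs ≡ just b

  -- paths from u to v (vertex sequence without repetition); a path is
  -- determined by (and determines) its vertex sequence from u to v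
  UVPath : Fin n → Fin n → List (Fin n) → Set
  UVPath u v xs = Walk u v xs × Unique xs

  TwoConnected : Set
  TwoConnected = 3 ≤ n ×
    (∀ w a b → a ≢ w → b ≢ w →
       ∃ λ xs → Walk a b xs × ¬ (w L.∈ xs))

  -- σ (an edge set) is a cycle: the edge set of a closed walk
  -- x ∷ ys ++ [x] with at least 3 distinct vertices
  IsCycle : EdgeSet → Set
  IsCycle σ = ∃ λ x → ∃ λ ys →
    2 ≤ length ys × Unique (x ∷ ys) ×
    Chain (x ∷ ys ++ x ∷ []) × EdgesOf (x ∷ ys ++ x ∷ []) σ

  _Δ_ : EdgeSet → EdgeSet → EdgeSet
  _Δ_ = zipWith _xor_

  Unicycle : EdgeSet → Set
  Unicycle U = ∃ λ σ → IsCycle σ × σ ⊆ U ×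
    (∀ τ → IsCycle τ → τ ⊆ U → τ ≡ σ)

  PropΔ* : (EdgeSet → Set) → EdgeSet → Set
  PropΔ* D σ = ∀ U → Unicycle U → σ ⊆ U →
    ∃ λ e → e ∉ U × ∃ λ α → ∃ λ β →
      D α × D β × α ⊆ (U ∪ ⁅ e ⁆) × β ⊆ (U ∪ ⁅ e ⁆) × σ ≡ α Δ β

  -- 𝒞 extended by the cycles added so far (listed newest first)
  Ext : (EdgeSet → Set) → List EdgeSet → EdgeSet → Set
  Ext 𝒞 σs τ = 𝒞 τ ⊎ τ L.∈ σs

  data ClosureRun (𝒞 : EdgeSet → Set) : List EdgeSet → Set where
    start : ClosureRun 𝒞 []
    add   : ∀ {σs σ} → ClosureRun 𝒞 σs → IsCycle σ →
            ¬ Ext 𝒞 σs σ → PropΔ* (Ext 𝒞 σs) σ → ClosureRun 𝒞 (σ ∷ σs)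

  -- Δ*-dense: the closure process reaches the set of all cycles
  -- (the final set Cl(𝒞) does not depend on the run chosen)
  Δ*-Dense : (EdgeSet → Set) → Set
  Δ*-Dense 𝒞 = ∃ λ σs → ClosureRun 𝒞 σs × (∀ τ → IsCycle τ → Ext 𝒞 σs τ)

  -- adjacency in P_𝒞(G_uv): S = P ++ x ∷ Sin ++ y ∷ Q and
  -- T = P ++ x ∷ Tin ++ y ∷ Q with S_xy, T_xy internally disjoint, and the
  -- cycle S_xy ∪ T_xy (= S Δ T) belongs to 𝒞
  AdjP : (EdgeSet → Set) → Fin n → Fin n → List (Fin n) → List (Fin n) → Set
  AdjP 𝒞 u v S T = UVPath u v S × UVPath u v T ×
    ∃ λ P → ∃ λ Q → ∃ λ x → ∃ λ y → ∃ λ Sin → ∃ λ Tin →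
      S ≡ P ++ x ∷ Sin ++ y ∷ Q × T ≡ P ++ x ∷ Tin ++ y ∷ Q ×
      (∀ z → z L.∈ Sin → ¬ (z L.∈ Tin)) ×
      ∃ λ c → 𝒞 c ×
        (∀ e → (e ∈ c) ⇔ (OnList (x ∷ Sin ++ y ∷ []) e ⊎ OnList (x ∷ Tin ++ y ∷ []) e))

  PathGraphConnected : (EdgeSet → Set) → Fin n → Fin n → Set
  PathGraphConnected 𝒞 u v = ∀ S T → UVPath u v S → UVPath u v T →
    Star (AdjP 𝒞 u v) S T

{-# OPTIONS --safe #-}
-- The full path graph P(G_uv) is connected: two uv-paths S and T agree up
-- to some vertex x; following T from x until it first meets S again, at y,
-- gives a segment T_xy internally disjoint from S, and replacing S_xy by it is
-- an adjacency that lengthens the common prefix.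
--
-- It remains to show, by induction along the closure process, that an
-- adjacency through a cycle of 𝒞_t is a sequence of adjacencies through
-- cycles of 𝒞.  If σ = σ_t was added by Property Δ*, apply Δ* to the unicycle
-- σ itself: this gives a chord e of σ and α, β ∈ 𝒞_{t-1} inside σ + e with
-- σ = α Δ β, and α, β must be the two cycles into which e cuts σ.  If
-- S Δ T = σ, rerouting S through e yields a uv-path R with S Δ R and R Δ T
-- equal to α and β in some order.
module Submission where

open import Defs
open import Data.Fin using (Fin; _≟_)
open import Data.Fin.Subset using (Subset; _∈_; _∉_; _⊆_; _∪_; ⁅_⁆)
open import Data.Fin.Subset.Properties using (⊆-antisym; x∈p∪q⁻; x∈⁅y⁆⇒x≡y) renaming (_∈?_ to _∈ₛ?_)
open import Data.Nat using (zero; suc; _≤_; z≤n; s≤s)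
open import Data.Nat.Properties using (≤-refl; ≤-trans; ≤-pred; ≤-reflexive)
open import Data.Bool using (true; false; _xor_)
open import Data.Vec using (tabulate; lookup)
open import Data.Vec.Properties using (lookup∘tabulate; lookup-zipWith; []=⇒lookup; lookup⇒[]=)
open import Data.List using (List; []; _∷_; _++_; head; last; length; [_]; reverse)
open import Data.List.Properties using (++-assoc; length-reverse; length-++-≤ʳ; ∷-injective; ∷-injectiveˡ; ∷-injectiveʳ; unfold-reverse; reverse-++)
import Data.List.Membership.Propositional as L
open import Data.List.Membership.Propositional.Properties using (∈-++⁺ˡ; ∈-++⁺ʳ; ∈-++⁻; ∈-∃++)
open import Data.List.Relation.Unary.Any using (here; there)
import Data.List.Relation.Unary.Any.Properties as Any
open import Data.List.Relation.Unary.All.Properties using (¬Any⇒All¬)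
open import Data.List.Relation.Unary.AllPairs using ([]; _∷_)
open import Data.List.Relation.Unary.Unique.Propositional using (Unique)
open import Data.List.Relation.Unary.Unique.Propositional.Properties using (++⁺; Unique[x∷xs]⇒x∉xs)
open import Data.List.Relation.Binary.Disjoint.Propositional using (Disjoint)
open import Data.Maybe using (just)
open import Data.Product using (∃; _×_; _,_; proj₁; proj₂)
open import Data.Product.Properties using (≡-dec)
open import Data.Sum using (_⊎_; inj₁; inj₂; swap) renaming (map to ⊎-map)
open import Data.Unit using (tt)
open import Data.Empty using (⊥; ⊥-elim)
open import Relation.Nullary using (¬_; Dec; yes; no; does)
open import Relation.Nullary.Decidable using (_⊎-dec_; dec-true)
open import Relation.Binary.PropositionalEquality
  using (_≡_; _≢_; refl; sym; trans; cong; cong₂; subst; subst₂; module ≡-Reasoning)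
open import Relation.Binary.Construct.Closure.ReflexiveTransitive using (Star; ε; _◅_; _⋆)
open import Function using (_∘_)
open import Function.Bundles using (_⇔_; mk⇔; Equivalence)
open import Function.Properties.Equivalence using (⇔-setoid) renaming (refl to ⇔-refl; sym to ⇔-sym; trans to ⇔-trans)
open import Data.Sum.Function.Propositional using (_⊎-⇔_)
open import Level using (0ℓ)
import Relation.Binary.Reasoning.Setoid as SetoidReasoning

module PathGraph (G : Graph) where
  open Graph G

  Vertex : Set
  Vertex = Fin n

  Edge : Set
  Edge = Fin m

  open import Data.List.Membership.DecPropositional (_≟_ {n}) using (_∈?_)

  Incident : Edge → Vertex → Set
  Incident g w = proj₁ (ends g) ≡ w ⊎ proj₂ (ends g) ≡ w

  module _ {g : Edge} {x y : Vertex} where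

    Joins-sym : Joins g x y → Joins g y x
    Joins-sym = swap

    Joins⇒Incidentˡ : Joins g x y → Incident g x
    Joins⇒Incidentˡ (inj₁ p) = inj₁ (cong proj₁ p)
    Joins⇒Incidentˡ (inj₂ p) = inj₂ (cong proj₂ p)

    Joins⇒Incidentʳ : Joins g x y → Incident g y
    Joins⇒Incidentʳ (inj₁ p) = inj₂ (cong proj₂ p)
    Joins⇒Incidentʳ (inj₂ p) = inj₁ (cong proj₁ p)

    Incident⇒end : ∀ {w} → Joins g x y → Incident g w → w ≡ x ⊎ w ≡ y
    Incident⇒end (inj₁ p) (inj₁ q) = inj₁ (trans (sym q) (cong proj₁ p))
    Incident⇒end (inj₁ p) (inj₂ q) = inj₂ (trans (sym q) (cong proj₂ p))
    Incident⇒end (inj₂ p) (inj₁ q) = inj₂ (trans (sym q) (cong proj₁ p))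
    Incident⇒end (inj₂ p) (inj₂ q) = inj₁ (trans (sym q) (cong proj₂ p))

    Joins⇒≢ : Joins g x y → x ≢ y
    Joins⇒≢ (inj₁ p) x≡y = loopless g (trans (cong proj₁ p) (trans x≡y (sym (cong proj₂ p))))
    Joins⇒≢ (inj₂ p) x≡y = loopless g (trans (cong proj₁ p) (trans (sym x≡y) (sym (cong proj₂ p))))

  Joins-injective : ∀ {g h x y} → Joins g x y → Joins h x y → g ≡ h
  Joins-injective {g} {h} {x} {y} = simple g h x y

  Joins-otherEnd : ∀ {g a w b} → Joins g a w → Joins g w b → a ≢ w → a ≡ b
  Joins-otherEnd (inj₁ p) (inj₁ q) a≢w = ⊥-elim (a≢w (trans (cong proj₁ (sym p)) (cong proj₁ q)))
  Joins-otherEnd (inj₁ p) (inj₂ q) a≢w = trans (cong proj₁ (sym p)) (cong proj₁ q)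
  Joins-otherEnd (inj₂ p) (inj₁ q) a≢w = trans (cong proj₂ (sym p)) (cong proj₂ q)
  Joins-otherEnd (inj₂ p) (inj₂ q) a≢w = ⊥-elim (a≢w (trans (cong proj₂ (sym p)) (cong proj₂ q)))

  joins? : ∀ g x y → Dec (Joins g x y)
  joins? g x y = ≡-dec _≟_ _≟_ (ends g) (x , y) ⊎-dec ≡-dec _≟_ _≟_ (ends g) (y , x)

  onList? : ∀ xs g → Dec (OnList xs g)
  onList? []           g = no λ ()
  onList? (x ∷ [])     g = no λ ()
  onList? (x ∷ y ∷ xs) g = joins? g x y ⊎-dec onList? (y ∷ xs) g

  ∈-Δ⇒∉ : ∀ {α β : EdgeSet} {g} → g ∈ α Δ β → g ∈ α → g ∉ β
  ∈-Δ⇒∉ {α} {β} {g} gΔ gα gβ = false≢true (begin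
    false                         ≡⟨ cong₂ _xor_ (sym ([]=⇒lookup gα)) (sym ([]=⇒lookup gβ)) ⟩
    lookup α g xor lookup β g     ≡⟨ sym (lookup-zipWith _xor_ g α β) ⟩
    lookup (α Δ β) g              ≡⟨ []=⇒lookup gΔ ⟩
    true                          ∎)
    where
    open ≡-Reasoning
    false≢true : false ≢ true
    false≢true ()

  edgeSetOf : List Vertex → EdgeSet
  edgeSetOf xs = tabulate λ g → does (onList? xs g)

  EdgesOf-edgeSetOf : ∀ xs → EdgesOf xs (edgeSetOf xs)
  EdgesOf-edgeSetOf xs g = mk⇔ to from
    where
    lookup-edgeSetOf : lookup (edgeSetOf xs) g ≡ does (onList? xs g)
    lookup-edgeSetOf = lookup∘tabulate (λ g → does (onList? xs g)) g
    to : g ∈ edgeSetOf xs → OnList xs g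
    to g∈ with onList? xs g | trans (sym lookup-edgeSetOf) ([]=⇒lookup g∈)
    ... | yes p | _ = p
    from : OnList xs g → g ∈ edgeSetOf xs
    from p = lookup⇒[]= g _ (trans lookup-edgeSetOf (dec-true (onList? xs g) p))

  Unique-tail : ∀ {x : Vertex} {xs} → Unique (x ∷ xs) → Unique xs
  Unique-tail (_ ∷ u) = u

  Unique-∷ : ∀ {x : Vertex} {xs} → x L.∉ xs → Unique xs → Unique (x ∷ xs)
  Unique-∷ x∉ u = ¬Any⇒All¬ _ x∉ ∷ u

  Unique-++⁻ : ∀ (xs : List Vertex) {ys} → Unique (xs ++ ys) → Unique xs × Unique ys × Disjoint xs ys
  Unique-++⁻ []       u = [] , u , λ ()
  Unique-++⁻ (x ∷ xs) u with Unique-++⁻ xs (Unique-tail u)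
  ... | uxs , uys , xs#ys = Unique-∷ (λ x∈ → x∉ (∈-++⁺ˡ x∈)) uxs , uys , x∷xs#ys
    where
    x∉ = Unique[x∷xs]⇒x∉xs u
    x∷xs#ys : Disjoint (x ∷ xs) _
    x∷xs#ys (here refl , x∈) = x∉ (∈-++⁺ʳ xs x∈)
    x∷xs#ys (there z∈ , z∈′) = xs#ys (z∈ , z∈′)

  Unique-reverse : ∀ {xs : List Vertex} → Unique xs → Unique (reverse xs)
  Unique-reverse {[]}     u = u
  Unique-reverse {x ∷ xs} u = subst Unique (sym (unfold-reverse x xs))
    (++⁺ (Unique-reverse (Unique-tail u)) (Unique-∷ (λ ()) [])
         λ { (z∈ , here refl) → Unique[x∷xs]⇒x∉xs u (Any.reverse⁻ z∈) })

  reverse-∷ʳ : ∀ (xs : List Vertex) y → reverse (xs ++ [ y ]) ≡ y ∷ reverse xs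
  reverse-∷ʳ xs y = reverse-++ xs [ y ]

  reverse-∷∷ : ∀ (x y : Vertex) zs → reverse (x ∷ y ∷ zs) ≡ reverse zs ++ y ∷ x ∷ []
  reverse-∷∷ x y zs = begin
    reverse (x ∷ y ∷ zs)           ≡⟨ unfold-reverse x (y ∷ zs) ⟩
    reverse (y ∷ zs) ++ [ x ]      ≡⟨ cong (_++ [ x ]) (unfold-reverse y zs) ⟩
    (reverse zs ++ [ y ]) ++ [ x ] ≡⟨ ++-assoc (reverse zs) [ y ] [ x ] ⟩
    reverse zs ++ y ∷ x ∷ []       ∎
    where open ≡-Reasoning

  OnList-++⁻ : ∀ xs {y ys g} → OnList (xs ++ y ∷ ys) g → OnList (xs ++ [ y ]) g ⊎ OnList (y ∷ ys) g
  OnList-++⁻ []            p        = inj₂ p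
  OnList-++⁻ (x ∷ [])      (inj₁ p) = inj₁ (inj₁ p)
  OnList-++⁻ (x ∷ [])      (inj₂ p) = inj₂ p
  OnList-++⁻ (x ∷ x′ ∷ xs) (inj₁ p) = inj₁ (inj₁ p)
  OnList-++⁻ (x ∷ x′ ∷ xs) (inj₂ p) with OnList-++⁻ (x′ ∷ xs) p
  ... | inj₁ q = inj₁ (inj₂ q)
  ... | inj₂ q = inj₂ q

  OnList-++⁺ˡ : ∀ xs {y ys g} → OnList (xs ++ [ y ]) g → OnList (xs ++ y ∷ ys) g
  OnList-++⁺ˡ (x ∷ [])      (inj₁ p) = inj₁ p
  OnList-++⁺ˡ (x ∷ x′ ∷ xs) (inj₁ p) = inj₁ p
  OnList-++⁺ˡ (x ∷ x′ ∷ xs) (inj₂ p) = inj₂ (OnList-++⁺ˡ (x′ ∷ xs) p)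

  OnList-++⁺ʳ : ∀ xs {y ys g} → OnList (y ∷ ys) g → OnList (xs ++ y ∷ ys) g
  OnList-++⁺ʳ []            p = p
  OnList-++⁺ʳ (x ∷ [])      p = inj₂ p
  OnList-++⁺ʳ (x ∷ x′ ∷ xs) p = inj₂ (OnList-++⁺ʳ (x′ ∷ xs) p)

  Chain-++⁻ : ∀ xs {y ys} → Chain (xs ++ y ∷ ys) → Chain (xs ++ [ y ]) × Chain (y ∷ ys)
  Chain-++⁻ []            c       = tt , c
  Chain-++⁻ (x ∷ [])      (a , c) = (a , tt) , c
  Chain-++⁻ (x ∷ x′ ∷ xs) (a , c) with Chain-++⁻ (x′ ∷ xs) c
  ... | c₁ , c₂ = (a , c₁) , c₂

  Chain-++⁺ : ∀ xs {y ys} → Chain (xs ++ [ y ]) → Chain (y ∷ ys) → Chain (xs ++ y ∷ ys)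
  Chain-++⁺ []            _        c = c
  Chain-++⁺ (x ∷ [])      (a , _)  c = a , c
  Chain-++⁺ (x ∷ x′ ∷ xs) (a , c₁) c = a , Chain-++⁺ (x′ ∷ xs) c₁ c

  OnList⇒∈ : ∀ xs {g w} → OnList xs g → Incident g w → w L.∈ xs
  OnList⇒∈ (x ∷ y ∷ xs) (inj₁ j) i with Incident⇒end j i
  ... | inj₁ refl = here refl
  ... | inj₂ refl = there (here refl)
  OnList⇒∈ (x ∷ y ∷ xs) (inj₂ p) i = there (OnList⇒∈ (y ∷ xs) p i)

  OnList-reverse⁺ : ∀ xs {g} → OnList xs g → OnList (reverse xs) g
  OnList-reverse⁺ (x ∷ y ∷ xs) {g} p = subst (λ L → OnList L g) (sym (reverse-∷∷ x y xs)) (go p)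
    where
    go : OnList (x ∷ y ∷ xs) g → OnList (reverse xs ++ y ∷ x ∷ []) g
    go (inj₁ j) = OnList-++⁺ʳ (reverse xs) (inj₁ (Joins-sym j))
    go (inj₂ q) = OnList-++⁺ˡ (reverse xs) (subst (λ L → OnList L g) (unfold-reverse y xs) (OnList-reverse⁺ (y ∷ xs) q))

  OnList-reverse⁻ : ∀ xs {g} → OnList (reverse xs) g → OnList xs g
  OnList-reverse⁻ (x ∷ y ∷ xs) {g} p =
    back (OnList-reverse⁻ (y ∷ xs)) (OnList-++⁻ (reverse xs) (subst (λ L → OnList L g) (reverse-∷∷ x y xs) p))
    where
    back : (OnList (reverse (y ∷ xs)) g → OnList (y ∷ xs) g) →
           OnList (reverse xs ++ [ y ]) g ⊎ OnList (y ∷ x ∷ []) g → OnList (x ∷ y ∷ xs) g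
    back ih (inj₁ q)        = inj₂ (ih (subst (λ L → OnList L g) (sym (unfold-reverse y xs)) q))
    back ih (inj₂ (inj₁ j)) = inj₁ (Joins-sym j)

  Chain-reverse : ∀ xs → Chain xs → Chain (reverse xs)
  Chain-reverse []           _ = tt
  Chain-reverse (x ∷ [])     _ = tt
  Chain-reverse (x ∷ y ∷ xs) ((g , j) , c) = subst Chain (sym (reverse-∷∷ x y xs))
    (Chain-++⁺ (reverse xs) (subst Chain (unfold-reverse y xs) (Chain-reverse (y ∷ xs) c)) ((g , Joins-sym j) , tt))

  ++-∷-nonEmpty : ∀ (L₁ : List Vertex) {s L} → L₁ ++ s ∷ L ≢ []
  ++-∷-nonEmpty []      ()
  ++-∷-nonEmpty (_ ∷ _) ()

  ∷ʳ-split : ∀ (ys : List Vertex) {xs z c cs} → xs ++ [ z ] ≡ ys ++ c ∷ cs →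
    ∃ λ ds → (c ∷ cs ≡ ds ++ [ z ]) × (xs ≡ ys ++ ds)
  ∷ʳ-split []       {xs}     eq = xs , sym eq , refl
  ∷ʳ-split (y ∷ ys) {[]}     eq = ⊥-elim (++-∷-nonEmpty ys (sym (∷-injectiveʳ eq)))
  ∷ʳ-split (y ∷ ys) {x ∷ xs} eq with ∷-injective eq
  ... | refl , eq′ with ∷ʳ-split ys {xs} eq′
  ...   | ds , e₁ , e₂ = ds , e₁ , cong (y ∷_) e₂

  OnList⇒split : ∀ L {g} → OnList L g → ∃ λ L₁ → ∃ λ s → ∃ λ t → ∃ λ L₂ → (L ≡ L₁ ++ s ∷ t ∷ L₂) × Joins g s t
  OnList⇒split (x ∷ y ∷ L) (inj₁ j) = [] , x , y , L , refl , j
  OnList⇒split (x ∷ y ∷ L) (inj₂ p) with OnList⇒split (y ∷ L) p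
  ... | L₁ , s , t , L₂ , eq , j = x ∷ L₁ , s , t , L₂ , cong (x ∷_) eq , j

  OnList-lastPair : ∀ L₁ {s t L₂ K c d g} → L₁ ++ s ∷ t ∷ L₂ ≡ K ++ c ∷ d ∷ [] → Joins g c d → OnList (s ∷ t ∷ L₂) g
  OnList-lastPair []           {K = K} {g = g} eq j = subst (λ L → OnList L g) (sym eq) (OnList-++⁺ʳ K (inj₁ j))
  OnList-lastPair (_ ∷ [])     {K = []} eq j with ∷-injectiveʳ eq
  ... | ()
  OnList-lastPair (_ ∷ _ ∷ L₁) {K = []} eq j = ⊥-elim (++-∷-nonEmpty L₁ (∷-injectiveʳ (∷-injectiveʳ eq)))
  OnList-lastPair (_ ∷ L₁)     {K = _ ∷ K} eq j = OnList-lastPair L₁ (∷-injectiveʳ eq) j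

  headOr : Vertex → List Vertex → Vertex
  headOr d []      = d
  headOr d (x ∷ _) = x

  headOr-∈ : ∀ d (A : List Vertex) → headOr d A L.∈ d ∷ A
  headOr-∈ d []      = here refl
  headOr-∈ d (x ∷ A) = there (here refl)

  ∷≡++⇒headOr : ∀ (L₁ : List Vertex) {a k K rest} → k ∷ K ≡ L₁ ++ a ∷ rest → k ≡ headOr a L₁
  ∷≡++⇒headOr []      eq = ∷-injectiveˡ eq
  ∷≡++⇒headOr (_ ∷ _) eq = ∷-injectiveˡ eq

  lastOr : Vertex → List Vertex → Vertex
  lastOr d []       = d
  lastOr d (x ∷ xs) = lastOr x xs

  lastOr-∈ : ∀ d (A : List Vertex) → lastOr d A L.∈ d ∷ A
  lastOr-∈ d []      = here refl
  lastOr-∈ d (x ∷ A) = there (lastOr-∈ x A)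

  Chain-last : ∀ x A {w} → Chain ((x ∷ A) ++ [ w ]) → Adj (lastOr x A) w
  Chain-last x []      (a , _) = a
  Chain-last x (y ∷ A) (_ , c) = Chain-last y A c

  OnList-last : ∀ x A {w g} → Joins g (lastOr x A) w → OnList ((x ∷ A) ++ [ w ]) g
  OnList-last x []      j = inj₁ j
  OnList-last x (y ∷ A) j = inj₂ (OnList-last y A j)

  Chain-first : ∀ w B x → Chain (w ∷ B ++ [ x ]) → Adj w (headOr x B)
  Chain-first w []      x (a , _) = a
  Chain-first w (b ∷ B) x (a , _) = a

  OnList-first : ∀ w B x {L g} → Joins g w (headOr x B) → OnList (w ∷ B ++ x ∷ L) g
  OnList-first w []      x j = inj₁ j
  OnList-first w (b ∷ B) x j = inj₁ j

  length≥2⇒ends : ∀ (ys : List Vertex) → 2 ≤ length ys → ∃ λ y₁ → ∃ λ mid → ∃ λ yₗ → ys ≡ y₁ ∷ mid ++ [ yₗ ]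
  length≥2⇒ends (y₁ ∷ [])      (s≤s ())
  length≥2⇒ends (y₁ ∷ y₂ ∷ ys) _ with initLast y₂ ys
    where
    initLast : ∀ (y : Vertex) ys → ∃ λ mid → ∃ λ yₗ → y ∷ ys ≡ mid ++ [ yₗ ]
    initLast y []       = [] , y , refl
    initLast y (z ∷ zs) with initLast z zs
    ... | mid , yₗ , eq = y ∷ mid , yₗ , cong (y ∷_) eq
  ... | mid , yₗ , eq = y₁ , mid , yₗ , cong (y₁ ∷_) eq

  Incident-first : ∀ {w : Vertex} L {g} → w L.∉ L → OnList (w ∷ L) g → Incident g w → Joins g w (headOr w L)
  Incident-first (b ∷ L) w∉ (inj₁ j) i = j
  Incident-first (b ∷ L) w∉ (inj₂ p) i = ⊥-elim (w∉ (OnList⇒∈ (b ∷ L) p i))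

  Incident-inner : ∀ L₁ {a w b : Vertex} L₂ {g} → w L.∉ L₁ → w ≢ a → w ≢ b → w L.∉ L₂ →
    OnList (L₁ ++ a ∷ w ∷ b ∷ L₂) g → Incident g w → Joins g a w ⊎ Joins g w b
  Incident-inner L₁ L₂ w∉L₁ w≢a w≢b w∉L₂ p i with OnList-++⁻ L₁ p
  ... | inj₂ (inj₁ j) = inj₁ j
  ... | inj₂ (inj₂ q) = inj₂ (Incident-first (_ ∷ L₂) (λ { (here e) → w≢b e ; (there k) → w∉L₂ k }) q i)
  ... | inj₁ q with ∈-++⁻ L₁ (OnList⇒∈ (L₁ ++ [ _ ]) q i)
  ...   | inj₁ k        = ⊥-elim (w∉L₁ k)
  ...   | inj₂ (here e) = ⊥-elim (w≢a e)

  -- z = k is allowed, so that closed walks are covered.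
  innerVertex-unique : ∀ k K z L₁ a w b L₂ → Unique (k ∷ K) → z L.∉ K →
    k ∷ K ++ [ z ] ≡ L₁ ++ a ∷ w ∷ b ∷ L₂ →
    w L.∈ K × w L.∉ L₁ × w ≢ a × w ≢ b × w L.∉ L₂
  innerVertex-unique k K z L₁ a w b L₂ u z∉K eq
    with ∷ʳ-split (L₁ ++ a ∷ [ w ]) {k ∷ K} (trans eq (sym (++-assoc L₁ (a ∷ [ w ]) (b ∷ L₂))))
  ... | ds , b∷L₂≡ , k∷K≡ = w∈K , w∉L₁ , w≢a , (λ e → w∉b∷L₂ (here e)) , (λ i → w∉b∷L₂ (there i))
    where
    k∷K≡′ : k ∷ K ≡ L₁ ++ a ∷ w ∷ ds
    k∷K≡′ = trans k∷K≡ (++-assoc L₁ (a ∷ [ w ]) ds)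
    parts = Unique-++⁻ L₁ (subst Unique k∷K≡′ u)
    w∉L₁ : w L.∉ L₁
    w∉L₁ i = proj₂ (proj₂ parts) (i , there (here refl))
    w≢a : w ≢ a
    w≢a e = Unique[x∷xs]⇒x∉xs (proj₁ (proj₂ parts)) (here (sym e))
    w∉ds : w L.∉ ds
    w∉ds = Unique[x∷xs]⇒x∉xs (Unique-tail (proj₁ (proj₂ parts)))
    w∈K : w L.∈ K
    w∈K with subst (w L.∈_) (sym k∷K≡′) (∈-++⁺ʳ L₁ (there (here refl)))
    ... | there i = i
    ... | here refl with subst (L._∈ a ∷ L₁) (sym (∷≡++⇒headOr L₁ k∷K≡′)) (headOr-∈ a L₁)
    ...   | here e  = ⊥-elim (w≢a e)
    ...   | there i = ⊥-elim (w∉L₁ i)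
    w∉b∷L₂ : w L.∉ b ∷ L₂
    w∉b∷L₂ i with ∈-++⁻ ds (subst (w L.∈_) b∷L₂≡ i)
    ... | inj₁ w∈ds        = w∉ds w∈ds
    ... | inj₂ (here refl) = z∉K w∈K

  -- Cycles

  MinDegree₂ : EdgeSet → Set
  MinDegree₂ γ = ∀ f w → f ∈ γ → Incident f w → ∃ λ g → g ∈ γ × g ≢ f × Incident g w

  Through : EdgeSet → Vertex → Vertex → Vertex → Set
  Through γ a w b = ∀ g → g ∈ γ → Incident g w → Joins g a w ⊎ Joins g w b

  Threaded : EdgeSet → List Vertex → Set
  Threaded γ W = ∀ L₁ a w b L₂ → W ≡ L₁ ++ a ∷ w ∷ b ∷ L₂ → Through γ a w b

  Threaded-walk : ∀ {γ} k K z → Unique (k ∷ K) → z L.∉ K →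
    (∀ {g w} → g ∈ γ → Incident g w → w L.∈ K → OnList (k ∷ K ++ [ z ]) g) →
    Threaded γ (k ∷ K ++ [ z ])
  Threaded-walk k K z u z∉K onWalk L₁ a w b L₂ eq g gγ i
    with innerVertex-unique k K z L₁ a w b L₂ u z∉K eq
  ... | w∈K , w∉L₁ , w≢a , w≢b , w∉L₂ =
    Incident-inner L₁ L₂ w∉L₁ w≢a w≢b w∉L₂ (subst (λ L → OnList L g) eq (onWalk gγ i w∈K)) i

  -- At each inner vertex γ has a second edge, which can only be the next edge of the walk.
  Threaded-spread : ∀ {γ W} → MinDegree₂ γ → Threaded γ W → ∀ L₁ {a b} L₂ → W ≡ L₁ ++ a ∷ b ∷ L₂ →
    ∀ {f} → f ∈ γ → Joins f a b → ∀ {g} → OnList (a ∷ b ∷ L₂) g → g ∈ γ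
  Threaded-spread deg th L₁ L₂ eq fγ jf (inj₁ j) = subst (_∈ _) (Joins-injective jf j) fγ
  Threaded-spread {γ} deg th L₁ {a} {b} (c ∷ L₂) eq {f} fγ jf (inj₂ p) = next (deg f b fγ (Joins⇒Incidentʳ jf))
    where
    next : (∃ λ h → h ∈ γ × h ≢ f × Incident h b) → _ ∈ γ
    next (h , hγ , h≢f , i) with th L₁ a b c L₂ eq h hγ i
    ... | inj₁ j = ⊥-elim (h≢f (Joins-injective j jf))
    ... | inj₂ j = Threaded-spread deg th (L₁ ++ [ a ]) L₂ (trans eq (sym (++-assoc L₁ [ a ] (b ∷ c ∷ L₂)))) hγ j p

  TwoEdgesAt : List Vertex → Vertex → Set
  TwoEdgesAt W w = ∃ λ g₁ → ∃ λ g₂ → OnList W g₁ × OnList W g₂ × g₁ ≢ g₂ × Incident g₁ w × Incident g₂ w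

  TwoEdgesAt-start : ∀ x y₁ mid yₗ → Unique (x ∷ y₁ ∷ mid ++ [ yₗ ]) → Chain (x ∷ (y₁ ∷ mid ++ [ yₗ ]) ++ [ x ]) →
    TwoEdgesAt (x ∷ (y₁ ∷ mid ++ [ yₗ ]) ++ [ x ]) x
  TwoEdgesAt-start x y₁ mid yₗ u ((g₁ , j₁) , c)
    with Chain-++⁻ (x ∷ y₁ ∷ mid) (subst (λ L → Chain (x ∷ y₁ ∷ L)) assoc ((g₁ , j₁) , c))
    where assoc = ++-assoc mid [ yₗ ] [ x ]
  ... | _ , ((g₂ , j₂) , _) = g₁ , g₂ , inj₁ j₁ , onW , g₁≢g₂ , Joins⇒Incidentˡ j₁ , Joins⇒Incidentʳ j₂
    where
    onW : OnList (x ∷ (y₁ ∷ mid ++ [ yₗ ]) ++ [ x ]) g₂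
    onW = subst (λ L → OnList (x ∷ y₁ ∷ L) g₂) (sym (++-assoc mid [ yₗ ] [ x ])) (OnList-++⁺ʳ (x ∷ y₁ ∷ mid) (inj₁ j₂))
    g₁≢g₂ : g₁ ≢ g₂
    g₁≢g₂ refl = Unique[x∷xs]⇒x∉xs (Unique-tail u)
      (subst (L._∈ mid ++ [ yₗ ]) (sym (Joins-otherEnd (Joins-sym j₁) (Joins-sym j₂) (λ e → Joins⇒≢ j₁ (sym e))))
             (∈-++⁺ʳ mid (here refl)))

  neighbours-distinct : ∀ x A w B → Unique (x ∷ A ++ w ∷ B) → 2 ≤ length (A ++ w ∷ B) → lastOr x A ≢ headOr x B
  neighbours-distinct x []       w []      u (s≤s ())
  neighbours-distinct x []       w (b ∷ B) u _ e = Unique[x∷xs]⇒x∉xs u (there (here e))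
  neighbours-distinct x (a₀ ∷ A) w []      u _ e = Unique[x∷xs]⇒x∉xs u (∈-++⁺ˡ (subst (L._∈ a₀ ∷ A) e (lastOr-∈ a₀ A)))
  neighbours-distinct x (a₀ ∷ A) w (b ∷ B) u _ e =
    proj₂ (proj₂ (Unique-++⁻ (a₀ ∷ A) (Unique-tail u))) (lastOr-∈ a₀ A , there (here e))

  TwoEdgesAt-inner : ∀ x A w B → Unique (x ∷ A ++ w ∷ B) → 2 ≤ length (A ++ w ∷ B) → Chain (x ∷ (A ++ w ∷ B) ++ [ x ]) →
    TwoEdgesAt (x ∷ (A ++ w ∷ B) ++ [ x ]) w
  TwoEdgesAt-inner x A w B u len c with Chain-++⁻ (x ∷ A) (subst (λ L → Chain (x ∷ L)) (++-assoc A (w ∷ B) [ x ]) c)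
  ... | c₁ , c₂ with Chain-last x A c₁ | Chain-first w B x c₂
  ...   | g₁ , j₁ | g₂ , j₂ = g₁ , g₂ , back (OnList-++⁺ˡ (x ∷ A) (OnList-last x A j₁)) ,
                              back (OnList-++⁺ʳ (x ∷ A) (OnList-first w B x j₂)) , g₁≢g₂ ,
                              Joins⇒Incidentʳ j₁ , Joins⇒Incidentˡ j₂
    where
    back : ∀ {g} → OnList ((x ∷ A) ++ w ∷ B ++ [ x ]) g → OnList (x ∷ (A ++ w ∷ B) ++ [ x ]) g
    back {g} = subst (λ L → OnList (x ∷ L) g) (sym (++-assoc A (w ∷ B) [ x ]))
    g₁≢g₂ : g₁ ≢ g₂
    g₁≢g₂ refl = neighbours-distinct x A w B u len (Joins-otherEnd j₁ j₂ (Joins⇒≢ j₁))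

  IsCycle⇒MinDegree₂ : ∀ {τ} → IsCycle τ → MinDegree₂ τ
  IsCycle⇒MinDegree₂ {τ} (x , ys , len , u , ch , eo) f w fτ i = other (two (OnList⇒∈ W (Equivalence.to (eo f) fτ) i))
    where
    W = x ∷ ys ++ [ x ]
    other : TwoEdgesAt W w → ∃ λ g → g ∈ τ × g ≢ f × Incident g w
    other (g₁ , g₂ , o₁ , o₂ , g₁≢g₂ , i₁ , i₂) with f ≟ g₁
    ... | yes refl = g₂ , Equivalence.from (eo g₂) o₂ , (λ e → g₁≢g₂ (sym e)) , i₂
    ... | no f≢g₁  = g₁ , Equivalence.from (eo g₁) o₁ , (λ e → f≢g₁ (sym e)) , i₁
    atStart : w ≡ x → TwoEdgesAt W w
    atStart refl with length≥2⇒ends ys len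
    ... | y₁ , mid , yₗ , refl = TwoEdgesAt-start x y₁ mid yₗ u ch
    two : w L.∈ W → TwoEdgesAt W w
    two (here e) = atStart e
    two (there k) with ∈-++⁻ ys k
    ... | inj₂ (here e) = atStart e
    ... | inj₁ k′ with ∈-∃++ k′
    ...   | A , B , refl = TwoEdgesAt-inner x A w B u len ch

  IsCycle⇒edge : ∀ {τ} → IsCycle τ → ∃ λ f → f ∈ τ
  IsCycle⇒edge (x , y ∷ ys , len , u , ((f , j) , _) , eo) = f , Equivalence.from (eo f) (inj₁ j)

  -- τ spreads from any of its edges along the closed walk of σ to its last
  -- edge, and from there around the start vertex over the whole walk.
  cycle-⊆-cycle : ∀ {σ τ} → IsCycle σ → IsCycle τ → τ ⊆ σ → σ ≡ τ
  cycle-⊆-cycle {σ} {τ} (x , ys , len , u , ch , eo) cτ τ⊆σ =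
    ⊆-antisym (λ {g} gσ → allOfW (Equivalence.to (eo g) gσ)) τ⊆σ
    where
    W = x ∷ ys ++ [ x ]
    deg = IsCycle⇒MinDegree₂ cτ
    onW : ∀ {g} → g ∈ τ → OnList W g
    onW {g} gτ = Equivalence.to (eo g) (τ⊆σ gτ)
    threaded : Threaded τ W
    threaded = Threaded-walk x ys x u (Unique[x∷xs]⇒x∉xs u) (λ gτ _ _ → onW gτ)
    f₀ = proj₁ (IsCycle⇒edge cτ)
    f₀τ = proj₂ (IsCycle⇒edge cτ)
    allOfW : ∀ {g} → OnList W g → g ∈ τ
    allOfW with OnList⇒split W (onW f₀τ) | length≥2⇒ends ys len
    ... | L₁ , s , t , L₂ , eq , j | y₁ , mid , yₗ , refl = fromStart
      where
      W≡ : W ≡ (x ∷ y₁ ∷ mid) ++ yₗ ∷ x ∷ []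
      W≡ = cong (λ L → x ∷ y₁ ∷ L) (++-assoc mid [ yₗ ] [ x ])
      lastEdge = proj₁ (proj₂ (Chain-++⁻ (x ∷ y₁ ∷ mid) (subst Chain W≡ ch)))
      gₗ = proj₁ lastEdge
      jₗ = proj₂ lastEdge
      gₗτ : gₗ ∈ τ
      gₗτ = Threaded-spread deg threaded L₁ L₂ eq f₀τ j (OnList-lastPair L₁ {K = x ∷ y₁ ∷ mid} (trans (sym eq) W≡) jₗ)
      fromStart : ∀ {g} → OnList W g → g ∈ τ
      fromStart with deg gₗ x gₗτ (Joins⇒Incidentʳ jₗ)
      ... | h , hτ , h≢gₗ , i with OnList-++⁻ (x ∷ y₁ ∷ mid) (subst (λ L → OnList L h) W≡ (onW hτ))
      ...   | inj₁ q        = Threaded-spread deg threaded [] _ refl hτ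
                                (Incident-first (y₁ ∷ mid ++ [ yₗ ]) (Unique[x∷xs]⇒x∉xs u) q i)
      ...   | inj₂ (inj₁ j′) = ⊥-elim (h≢gₗ (Joins-injective j′ jₗ))

  IsCycle⇒Unicycle : ∀ {σ} → IsCycle σ → Unicycle σ
  IsCycle⇒Unicycle {σ} cσ = σ , cσ , (λ g∈ → g∈) , λ τ cτ τ⊆σ → sym (cycle-⊆-cycle cσ cτ τ⊆σ)

  -- A chord splits a cycle into two cycles

  arc : Vertex → List Vertex → Vertex → List Vertex
  arc p Fm q = p ∷ Fm ++ [ q ]

  reverse-arc : ∀ p Fm q → reverse (arc p Fm q) ≡ arc q (reverse Fm) p
  reverse-arc p Fm q = begin
    reverse (p ∷ Fm ++ [ q ])      ≡⟨ unfold-reverse p (Fm ++ [ q ]) ⟩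
    reverse (Fm ++ [ q ]) ++ [ p ] ≡⟨ cong (_++ [ p ]) (reverse-∷ʳ Fm q) ⟩
    arc q (reverse Fm) p           ∎
    where open ≡-Reasoning

  OnList-reverseArc : ∀ p Fm q {g} → OnList (arc p Fm q) g → OnList (arc q (reverse Fm) p) g
  OnList-reverseArc p Fm q {g} o = subst (λ L → OnList L g) (reverse-arc p Fm q) (OnList-reverse⁺ (arc p Fm q) o)

  Unique-reverseArc : ∀ {p Fm q} → Unique (arc p Fm q) → Unique (arc q (reverse Fm) p)
  Unique-reverseArc {p} {Fm} {q} u = subst Unique (reverse-arc p Fm q) (Unique-reverse u)

  arc-first : ∀ p Fm q → ∃ λ L₂ → arc p Fm q ≡ p ∷ headOr q Fm ∷ L₂
  arc-first p []       q = [] , refl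
  arc-first p (f ∷ Fm) q = Fm ++ [ q ] , refl

  Incident-arcStart : ∀ {p Fm q g} → Unique (arc p Fm q) → OnList (arc p Fm q) g → Incident g p → Joins g p (headOr q Fm)
  Incident-arcStart {p} {[]}     {q} u o i = Incident-first [ q ] (Unique[x∷xs]⇒x∉xs u) o i
  Incident-arcStart {p} {f ∷ Fm} {q} u o i = Incident-first (f ∷ Fm ++ [ q ]) (Unique[x∷xs]⇒x∉xs u) o i

  OnList-arc-reverse : ∀ p Fm q {g} → OnList (arc p Fm q) g ⇔ OnList (arc q (reverse Fm) p) g
  OnList-arc-reverse p Fm q {g} = mk⇔ (OnList-reverseArc p Fm q)
    (OnList-reverse⁻ (arc p Fm q) ∘ subst (λ L → OnList L g) (sym (reverse-arc p Fm q)))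

  WithChord : List Vertex → Edge → Edge → Set
  WithChord W e g = OnList W g ⊎ g ≡ e

  CycleOf : EdgeSet → Edge → List Vertex → Set
  CycleOf γ e W = ∀ g → (g ∈ γ) ⇔ WithChord W e g

  -- The cycle σ consists of the arcs F from p to q and B from q to p, and e
  -- is a chord joining p and q.
  record SplitByChord (σ : EdgeSet) (e : Edge) (p q : Vertex) (Fm Bm : List Vertex) : Set where
    field
      joins     : Joins e p q
      uniqueF   : Unique (arc p Fm q)
      uniqueB   : Unique (arc q Bm p)
      disjoint  : Disjoint Fm Bm
      coveredBy : ∀ {g} → g ∈ σ → OnList (arc p Fm q) g ⊎ OnList (arc q Bm p) g

  SplitByChord-swap : ∀ {σ e p q Fm Bm} → SplitByChord σ e p q Fm Bm → SplitByChord σ e q p Bm Fm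
  SplitByChord-swap s = record
    { joins = Joins-sym joins ; uniqueF = uniqueB ; uniqueB = uniqueF
    ; disjoint = λ (i , j) → disjoint (j , i) ; coveredBy = λ gσ → swap (coveredBy gσ) }
    where open SplitByChord s

  SplitByChord-reverse : ∀ {σ e p q Fm Bm} → SplitByChord σ e p q Fm Bm →
    SplitByChord σ e p q (reverse Bm) (reverse Fm)
  SplitByChord-reverse {p = p} {q} {Fm} {Bm} s = record
    { joins = joins ; uniqueF = Unique-reverseArc uniqueB ; uniqueB = Unique-reverseArc uniqueF
    ; disjoint = λ (i , j) → disjoint (Any.reverse⁻ j , Any.reverse⁻ i)
    ; coveredBy = λ gσ → swap (⊎-map (OnList-reverseArc p Fm q) (OnList-reverseArc q Bm p) (coveredBy gσ)) }
    where open SplitByChord s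

  module _ {σ e p q Fm Bm} (split : SplitByChord σ e p q Fm Bm) where
    open SplitByChord split

    arc-spread : ∀ {γ} → MinDegree₂ γ → (∀ {g} → g ∈ γ → g ≡ e ⊎ g ∈ σ) →
      ∀ {f} → f ∈ γ → Joins f p (headOr q Fm) → ∀ {g} → OnList (arc p Fm q) g → g ∈ γ
    arc-spread {γ} deg γ⊆σ+e fγ jf =
      Threaded-spread deg threaded [] (proj₁ (arc-first p Fm q)) (proj₂ (arc-first p Fm q)) fγ jf ∘ onArc
      where
      parts = Unique-++⁻ (p ∷ Fm) uniqueF
      p∉Fm = Unique[x∷xs]⇒x∉xs (proj₁ parts)
      q∉Fm : q L.∉ Fm
      q∉Fm i = proj₂ (proj₂ parts) (there i , here refl)
      onWalk : ∀ {g w} → g ∈ γ → Incident g w → w L.∈ Fm → OnList (arc p Fm q) g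
      onWalk gγ i w∈Fm with γ⊆σ+e gγ
      ... | inj₁ refl with Incident⇒end joins i
      ...   | inj₁ refl = ⊥-elim (p∉Fm w∈Fm)
      ...   | inj₂ refl = ⊥-elim (q∉Fm w∈Fm)
      onWalk gγ i w∈Fm | inj₂ gσ with coveredBy gσ
      ... | inj₁ o = o
      ... | inj₂ o with OnList⇒∈ (arc q Bm p) o i
      ...   | here refl = ⊥-elim (q∉Fm w∈Fm)
      ...   | there k with ∈-++⁻ Bm k
      ...     | inj₁ w∈Bm        = ⊥-elim (disjoint (w∈Fm , w∈Bm))
      ...     | inj₂ (here refl) = ⊥-elim (p∉Fm w∈Fm)
      threaded = Threaded-walk p Fm q (proj₁ parts) q∉Fm onWalk
      onArc : ∀ {g} → OnList (arc p Fm q) g → OnList (p ∷ headOr q Fm ∷ proj₁ (arc-first p Fm q)) g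
      onArc {g} = subst (λ L → OnList L g) (proj₂ (arc-first p Fm q))

  module _ {σ e p q Fm Bm} (split : SplitByChord σ e p q Fm Bm) where
    open SplitByChord split

    ContainsArc : EdgeSet → List Vertex → Set
    ContainsArc γ W = (∃ λ g → g ∈ γ × g ∈ σ × OnList W g) × (∀ {g} → OnList W g → g ∈ γ)

    -- The second edge of γ at p lies on F or on B, and γ follows that arc.
    cycleThroughChord-containsArc : ∀ {γ} → MinDegree₂ γ → e ∈ γ → (∀ {g} → g ∈ γ → g ≡ e ⊎ g ∈ σ) →
      ContainsArc γ (arc p Fm q) ⊎ ContainsArc γ (arc q Bm p)
    cycleThroughChord-containsArc deg eγ γ⊆σ+e with deg e p eγ (Joins⇒Incidentˡ joins)
    ... | g , gγ , g≢e , i with γ⊆σ+e gγ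
    ...   | inj₁ g≡e = ⊥-elim (g≢e g≡e)
    ...   | inj₂ gσ with coveredBy gσ
    ...     | inj₁ o = inj₁ ((g , gγ , gσ , o) , arc-spread split deg γ⊆σ+e gγ (Incident-arcStart uniqueF o i))
    ...     | inj₂ o = inj₂ ((g , gγ , gσ , o) ,
                λ o′ → arc-spread (SplitByChord-reverse split) deg γ⊆σ+e gγ
                         (Incident-arcStart (Unique-reverseArc uniqueB) (OnList-reverseArc q Bm p o) i)
                         (OnList-reverseArc q Bm p o′))

    cycleOf-arc : ∀ {α β W W′} → e ∈ α → (∀ {g} → g ∈ α → g ≡ e ⊎ g ∈ σ) → (∀ {g} → g ∈ σ → g ∈ α → g ∉ β) →
      (∀ {g} → g ∈ σ → OnList W g ⊎ OnList W′ g) →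
      (∀ {g} → OnList W g → g ∈ α) → (∀ {g} → OnList W′ g → g ∈ β) → CycleOf α e W
    cycleOf-arc {α} {W = W} eα α⊆σ+e σαβ σ⊆W∪W′ W⊆α W′⊆β g = mk⇔ to from
      where
      to : g ∈ α → OnList W g ⊎ g ≡ e
      to gα with α⊆σ+e gα
      ... | inj₁ g≡e = inj₂ g≡e
      ... | inj₂ gσ with σ⊆W∪W′ gσ
      ...   | inj₁ o = inj₁ o
      ...   | inj₂ o = ⊥-elim (σαβ gσ gα (W′⊆β o))
      from : OnList W g ⊎ g ≡ e → g ∈ α
      from (inj₁ o)    = W⊆α o
      from (inj₂ refl) = eα

    chord-splits-cycle : ∀ {α β} → MinDegree₂ α → MinDegree₂ β → e ∈ α → e ∈ β →
      (∀ {g} → g ∈ α → g ≡ e ⊎ g ∈ σ) → (∀ {g} → g ∈ β → g ≡ e ⊎ g ∈ σ) →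
      (∀ {g} → g ∈ σ → g ∈ α → g ∉ β) →
      (CycleOf α e (arc p Fm q) × CycleOf β e (arc q Bm p)) ⊎ (CycleOf α e (arc q Bm p) × CycleOf β e (arc p Fm q))
    chord-splits-cycle {α} {β} dα dβ eα eβ α⊆ β⊆ σαβ = cases
      where
      σβα : ∀ {g} → g ∈ σ → g ∈ β → g ∉ α
      σβα gσ gβ gα = σαβ gσ gα gβ
      cases : (CycleOf α e (arc p Fm q) × CycleOf β e (arc q Bm p)) ⊎ (CycleOf α e (arc q Bm p) × CycleOf β e (arc p Fm q))
      cases with cycleThroughChord-containsArc dα eα α⊆ | cycleThroughChord-containsArc dβ eβ β⊆
      ... | inj₁ ((g , gα , gσ , o) , _) | inj₁ (_ , F⊆β) = ⊥-elim (σαβ gσ gα (F⊆β o))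
      ... | inj₂ ((g , gα , gσ , o) , _) | inj₂ (_ , B⊆β) = ⊥-elim (σαβ gσ gα (B⊆β o))
      ... | inj₁ (_ , F⊆α) | inj₂ (_ , B⊆β) =
        inj₁ (cycleOf-arc eα α⊆ σαβ coveredBy F⊆α B⊆β , cycleOf-arc eβ β⊆ σβα (swap ∘ coveredBy) B⊆β F⊆α)
      ... | inj₂ (_ , B⊆α) | inj₁ (_ , F⊆β) =
        inj₂ (cycleOf-arc eα α⊆ σαβ (swap ∘ coveredBy) B⊆α F⊆β , cycleOf-arc eβ β⊆ σβα coveredBy F⊆β B⊆α)

  -- Rerouting a path

  last-++ : ∀ (L : List Vertex) {b B} → last (L ++ b ∷ B) ≡ last (b ∷ B)
  last-++ []          = refl
  last-++ (x ∷ [])    = refl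
  last-++ (x ∷ y ∷ L) = last-++ (y ∷ L)

  head-++ : ∀ (A : List Vertex) {a B B′} → head (A ++ a ∷ B) ≡ head (A ++ a ∷ B′)
  head-++ []      = refl
  head-++ (x ∷ A) = refl

  Unique-replace : ∀ A {a Mid b B N} → Unique (A ++ a ∷ Mid ++ b ∷ B) → Unique N →
    Disjoint N (A ++ a ∷ Mid ++ b ∷ B) → Unique (A ++ a ∷ N ++ b ∷ B)
  Unique-replace A {a} {Mid} {b} {B} {N} uS uN N#S with Unique-++⁻ A uS
  ... | uA , ua∷rest , A#rest with Unique-++⁻ Mid (Unique-tail ua∷rest)
  ...   | _ , ub∷B , _ = ++⁺ uA (Unique-∷ a∉ (++⁺ uN ub∷B N#b∷B)) A#new
    where
    b∷B⊆ : ∀ {z} → z L.∈ b ∷ B → z L.∈ a ∷ Mid ++ b ∷ B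
    b∷B⊆ = there ∘ ∈-++⁺ʳ Mid
    N#b∷B : Disjoint N (b ∷ B)
    N#b∷B (i , j) = N#S (i , ∈-++⁺ʳ A (b∷B⊆ j))
    a∉ : a L.∉ N ++ b ∷ B
    a∉ i with ∈-++⁻ N i
    ... | inj₁ k = N#S (k , ∈-++⁺ʳ A (here refl))
    ... | inj₂ k = Unique[x∷xs]⇒x∉xs ua∷rest (∈-++⁺ʳ Mid k)
    A#new : Disjoint A (a ∷ N ++ b ∷ B)
    A#new (i , here refl) = A#rest (i , here refl)
    A#new (i , there j) with ∈-++⁻ N j
    ... | inj₁ k = N#S (k , ∈-++⁺ˡ i)
    ... | inj₂ k = A#rest (i , b∷B⊆ k)

  UVPath-replace : ∀ {u v} A {a Mid b B} N → UVPath u v (A ++ a ∷ Mid ++ b ∷ B) → Chain (arc a N b) → Unique N →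
    Disjoint N (A ++ a ∷ Mid ++ b ∷ B) → UVPath u v (A ++ a ∷ N ++ b ∷ B)
  UVPath-replace A {a} {Mid} {b} {B} N ((c , h , l) , uS) cN uN N#S =
    (chain , trans (head-++ A) h , lastEq) , Unique-replace A uS uN N#S
    where
    cA,rest = Chain-++⁻ A c
    chain = Chain-++⁺ A (proj₁ cA,rest) (Chain-++⁺ (a ∷ N) cN (proj₂ (Chain-++⁻ (a ∷ Mid) (proj₂ cA,rest))))
    lastEq : last (A ++ a ∷ N ++ b ∷ B) ≡ just _
    lastEq = begin
      last (A ++ a ∷ N ++ b ∷ B)     ≡⟨ cong last (sym (++-assoc A (a ∷ N) (b ∷ B))) ⟩
      last ((A ++ a ∷ N) ++ b ∷ B)   ≡⟨ last-++ (A ++ a ∷ N) ⟩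
      last (b ∷ B)                   ≡⟨ sym (last-++ (A ++ a ∷ Mid)) ⟩
      last ((A ++ a ∷ Mid) ++ b ∷ B) ≡⟨ cong last (++-assoc A (a ∷ Mid) (b ∷ B)) ⟩
      last (A ++ a ∷ Mid ++ b ∷ B)   ≡⟨ l ⟩
      just _                         ∎
      where open ≡-Reasoning

  -- AdjP with the cycle S Δ T described by a predicate on edges
  Move : (Edge → Set) → Vertex → Vertex → List Vertex → List Vertex → Set
  Move Cyc u v S T = UVPath u v S × UVPath u v T ×
    ∃ λ P → ∃ λ Q → ∃ λ x → ∃ λ y → ∃ λ Sin → ∃ λ Tin →
      S ≡ P ++ x ∷ Sin ++ y ∷ Q × T ≡ P ++ x ∷ Tin ++ y ∷ Q ×
      (∀ z → z L.∈ Sin → z L.∉ Tin) ×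
      (∀ g → Cyc g ⇔ (OnList (arc x Sin y) g ⊎ OnList (arc x Tin y) g))

  Move-sym : ∀ {Cyc u v S T} → Move Cyc u v S T → Move Cyc u v T S
  Move-sym (pS , pT , P , Q , x , y , Sin , Tin , eS , eT , Sin#Tin , cyc) =
    pT , pS , P , Q , x , y , Tin , Sin , eT , eS , (λ z i j → Sin#Tin z j i) ,
    λ g → mk⇔ (swap ∘ Equivalence.to (cyc g)) (Equivalence.from (cyc g) ∘ swap)

  Move⇒AdjP : ∀ {Cyc u v S T} {D : EdgeSet → Set} {c} → D c → (∀ g → (g ∈ c) ⇔ Cyc g) →
    Move Cyc u v S T → AdjP D u v S T
  Move⇒AdjP Dc c⇔ (pS , pT , P , Q , x , y , Sin , Tin , eS , eT , Sin#Tin , cyc) =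
    pS , pT , P , Q , x , y , Sin , Tin , eS , eT , Sin#Tin , _ , Dc , λ g → ⇔-trans (c⇔ g) (cyc g)

  Unique-++-comm : ∀ (xs : List Vertex) {ys} → Unique (xs ++ ys) → Unique (ys ++ xs)
  Unique-++-comm xs u with Unique-++⁻ xs u
  ... | uxs , uys , xs#ys = ++⁺ uys uxs λ (i , j) → xs#ys (j , i)

  arc-++ : ∀ (x : Vertex) Z y L → arc x Z y ++ L ≡ x ∷ Z ++ y ∷ L
  arc-++ x Z y L = cong (x ∷_) (++-assoc Z [ y ] L)

  Unique-joinArcs : ∀ {x Z y T} → Unique (arc x Z y) → Unique T → Disjoint T (arc x Z y) →
    Unique (x ∷ Z ++ y ∷ reverse T)
  Unique-joinArcs {x} {Z} {y} {T} u uT T#arc = subst Unique (arc-++ x Z y (reverse T))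
    (++⁺ u (Unique-reverse uT) λ (i , j) → T#arc (Any.reverse⁻ j , i))

  OnList-concatArcs : ∀ a Z y W b {g} → OnList (a ∷ Z ++ y ∷ W ++ [ b ]) g ⇔ (OnList (arc a Z y) g ⊎ OnList (arc y W b) g)
  OnList-concatArcs a Z y W b = mk⇔ (OnList-++⁻ (a ∷ Z)) λ { (inj₁ o) → OnList-++⁺ˡ (a ∷ Z) o ; (inj₂ o) → OnList-++⁺ʳ (a ∷ Z) o }

  OnList-joinArcs : ∀ a Z y T b {g} → OnList (a ∷ Z ++ y ∷ reverse T ++ [ b ]) g ⇔ (OnList (arc a Z y) g ⊎ OnList (arc b T y) g)
  OnList-joinArcs a Z y T b = ⇔-trans (OnList-concatArcs a Z y (reverse T) b) (⇔-refl ⊎-⇔ ⇔-sym (OnList-arc-reverse b T y))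

  -- The closed walk C₁ ++ a ∷ M ++ b ∷ C₂ back to its start, cut at a and b.
  OnList-rotation : ∀ C₁ a M b C₂ {g} →
    OnList (C₁ ++ a ∷ M ++ b ∷ C₂ ++ [ headOr a C₁ ]) g ⇔ (OnList (arc a M b) g ⊎ OnList (arc b (C₂ ++ C₁) a) g)
  OnList-rotation C₁ a M b C₂ {g} = mk⇔ (to C₁) (from C₁)
    where
    back : ∀ {C₁} → OnList (b ∷ C₂ ++ C₁ ++ [ a ]) g → OnList (arc b (C₂ ++ C₁) a) g
    back {C₁} = subst (λ L → OnList (b ∷ L) g) (sym (++-assoc C₂ C₁ [ a ]))
    forth : ∀ {C₁} → OnList (arc b (C₂ ++ C₁) a) g → OnList (b ∷ C₂ ++ C₁ ++ [ a ]) g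
    forth {C₁} = subst (λ L → OnList (b ∷ L) g) (++-assoc C₂ C₁ [ a ])
    to : ∀ C₁ → OnList (C₁ ++ a ∷ M ++ b ∷ C₂ ++ [ headOr a C₁ ]) g → OnList (arc a M b) g ⊎ OnList (arc b (C₂ ++ C₁) a) g
    to [] o with OnList-++⁻ (a ∷ M) o
    ... | inj₁ o′ = inj₁ o′
    ... | inj₂ o′ = inj₂ (back {[]} o′)
    to (c ∷ C₁) o with OnList-++⁻ (c ∷ C₁) o
    ... | inj₁ o₁ = inj₂ (back (OnList-++⁺ʳ (b ∷ C₂) o₁))
    ... | inj₂ o₂ with OnList-++⁻ (a ∷ M) o₂
    ...   | inj₁ o′ = inj₁ o′
    ...   | inj₂ o′ = inj₂ (back (OnList-++⁺ˡ (b ∷ C₂) o′))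
    from : ∀ C₁ → OnList (arc a M b) g ⊎ OnList (arc b (C₂ ++ C₁) a) g → OnList (C₁ ++ a ∷ M ++ b ∷ C₂ ++ [ headOr a C₁ ]) g
    from []       (inj₁ o) = OnList-++⁺ˡ (a ∷ M) o
    from []       (inj₂ o) = OnList-++⁺ʳ (a ∷ M) (forth {[]} o)
    from (c ∷ C₁) (inj₁ o) = OnList-++⁺ʳ (c ∷ C₁) (OnList-++⁺ˡ (a ∷ M) o)
    from (c ∷ C₁) (inj₂ o) with OnList-++⁻ (b ∷ C₂) (forth o)
    ... | inj₁ o′ = OnList-++⁺ʳ (c ∷ C₁) (OnList-++⁺ʳ (a ∷ M) o′)
    ... | inj₂ o′ = OnList-++⁺ˡ (c ∷ C₁) o′

  SplitByChord-rotation : ∀ {σ e} C₁ {a M b} C₂ → Joins e a b → Unique (C₁ ++ a ∷ M ++ b ∷ C₂) →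
    (∀ {g} → g ∈ σ → OnList (C₁ ++ a ∷ M ++ b ∷ C₂ ++ [ headOr a C₁ ]) g) → SplitByChord σ e a b M (C₂ ++ C₁)
  SplitByChord-rotation C₁ {a} {M} {b} C₂ j u σ⊆ = record
    { joins = j
    ; uniqueF = proj₁ (Unique-++⁻ (arc a M b) (subst Unique (sym (arc-++ a M b K)) rotated))
    ; uniqueB = proj₁ (Unique-++⁻ (arc b K a) (subst Unique (sym (arc-++ b K a M))
                  (Unique-++-comm (a ∷ M) rotated)))
    ; disjoint = λ (i , k) → proj₂ (proj₂ (Unique-++⁻ M (Unique-tail rotated))) (i , there k)
    ; coveredBy = λ gσ → Equivalence.to (OnList-rotation C₁ a M b C₂) (σ⊆ gσ) }
    where
    K = C₂ ++ C₁
    rotated : Unique (a ∷ M ++ b ∷ K)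
    rotated = subst Unique (cong (a ∷_) (++-assoc M (b ∷ C₂) C₁)) (Unique-++-comm C₁ u)

  ∈-frame : ∀ P {x N y Q M z} → Unique (P ++ x ∷ N ++ y ∷ Q) → z L.∈ N → z L.∈ P ++ x ∷ M ++ y ∷ Q → z L.∈ M
  ∈-frame P {x} {N} {y} {Q} {M} u z∈N z∈ with Unique-++⁻ P u
  ... | _ , ux∷ , P#x∷ with ∈-++⁻ P z∈
  ...   | inj₁ z∈P        = ⊥-elim (P#x∷ (z∈P , there (∈-++⁺ˡ z∈N)))
  ...   | inj₂ (here refl) = ⊥-elim (Unique[x∷xs]⇒x∉xs ux∷ (∈-++⁺ˡ z∈N))
  ...   | inj₂ (there k) with ∈-++⁻ M k
  ...     | inj₁ z∈M   = z∈M
  ...     | inj₂ z∈y∷Q = ⊥-elim (proj₂ (proj₂ (Unique-++⁻ N (Unique-tail ux∷))) (z∈N , z∈y∷Q))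

  arc⊆ : ∀ P {x N y Q z} → z L.∈ arc x N y → z L.∈ P ++ x ∷ N ++ y ∷ Q
  arc⊆ P {x} {N} {y} {Q} {z} = ∈-++⁺ʳ P ∘ subst (z L.∈_) (arc-++ x N y Q) ∘ ∈-++⁺ˡ

  Unique-arc : ∀ P {x N y Q} → Unique (P ++ x ∷ N ++ y ∷ Q) → Unique (arc x N y)
  Unique-arc P {x} {N} {y} {Q} u =
    proj₁ (Unique-++⁻ (arc x N y) (subst Unique (sym (arc-++ x N y Q)) (proj₁ (proj₂ (Unique-++⁻ P u)))))

  Chain-arc : ∀ P {x N y Q} → Chain (P ++ x ∷ N ++ y ∷ Q) → Chain (arc x N y)
  Chain-arc P {x} {N} c = proj₁ (Chain-++⁻ (x ∷ N) (proj₂ (Chain-++⁻ P c)))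

  ++-assoc-segment : ∀ (L₁ : List Vertex) a M b L₂ W → (L₁ ++ a ∷ M ++ b ∷ L₂) ++ W ≡ L₁ ++ a ∷ M ++ b ∷ (L₂ ++ W)
  ++-assoc-segment L₁ a M b L₂ W =
    trans (++-assoc L₁ (a ∷ M ++ b ∷ L₂) W) (cong (λ L → L₁ ++ a ∷ L) (++-assoc M (b ∷ L₂) W))

  arc-reframe : ∀ {x Z y} L₁ {a} M {b} L₂ → arc x Z y ≡ L₁ ++ a ∷ M ++ b ∷ L₂ →
    ∀ W → x ∷ Z ++ y ∷ W ≡ L₁ ++ a ∷ M ++ b ∷ (L₂ ++ W)
  arc-reframe {x} {Z} {y} L₁ {a} M {b} L₂ eq W = begin
    x ∷ Z ++ y ∷ W                ≡⟨ sym (arc-++ x Z y W) ⟩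
    arc x Z y ++ W                ≡⟨ cong (_++ W) eq ⟩
    (L₁ ++ a ∷ M ++ b ∷ L₂) ++ W  ≡⟨ ++-assoc-segment L₁ a M b L₂ W ⟩
    L₁ ++ a ∷ M ++ b ∷ (L₂ ++ W)  ∎
    where open ≡-Reasoning

  joinArcs-rotation : ∀ {x Z y} L₁ {a} M {b} L₂ T → arc x Z y ≡ L₁ ++ a ∷ M ++ b ∷ L₂ →
    x ∷ Z ++ y ∷ reverse T ++ [ x ] ≡ L₁ ++ a ∷ M ++ b ∷ (L₂ ++ reverse T) ++ [ headOr a L₁ ]
  joinArcs-rotation {x} L₁ {a} M {b} L₂ T eq = begin
    x ∷ _ ++ _ ∷ reverse T ++ [ x ]                          ≡⟨ arc-reframe L₁ M L₂ eq (reverse T ++ [ x ]) ⟩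
    L₁ ++ a ∷ M ++ b ∷ (L₂ ++ reverse T ++ [ x ])            ≡⟨ cong (λ L → L₁ ++ a ∷ M ++ b ∷ L) rest ⟩
    L₁ ++ a ∷ M ++ b ∷ (L₂ ++ reverse T) ++ [ headOr a L₁ ] ∎
    where
    open ≡-Reasoning
    rest : L₂ ++ reverse T ++ [ x ] ≡ (L₂ ++ reverse T) ++ [ headOr a L₁ ]
    rest = trans (sym (++-assoc L₂ (reverse T) [ x ])) (cong (λ w → (L₂ ++ reverse T) ++ [ w ]) (∷≡++⇒headOr L₁ eq))

  ∷-headOr : ∀ (L₁ : List Vertex) a ds → ∃ λ Z → L₁ ++ a ∷ ds ≡ headOr a L₁ ∷ Z
  ∷-headOr []      a ds = ds , refl
  ∷-headOr (l ∷ L₁) a ds = L₁ ++ a ∷ ds , refl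

  arc-replace : ∀ {x Z y} L₁ {a M b} L₂ → arc x Z y ≡ L₁ ++ a ∷ M ++ b ∷ L₂ →
    ∀ N → ∃ λ Z′ → L₁ ++ a ∷ N ++ b ∷ L₂ ≡ arc x Z′ y
  arc-replace {x} {Z} {y} L₁ {a} {M} {b} L₂ eq N
    with ∷ʳ-split (L₁ ++ a ∷ M) {x ∷ Z} (trans eq (sym (++-assoc L₁ (a ∷ M) (b ∷ L₂))))
  ... | ds , b∷L₂≡ , _ with ∷-headOr L₁ a (N ++ ds)
  ...   | Z′ , eq′ = Z′ , (begin
    L₁ ++ a ∷ N ++ b ∷ L₂           ≡⟨ cong (λ L → L₁ ++ a ∷ N ++ L) b∷L₂≡ ⟩
    L₁ ++ a ∷ N ++ ds ++ [ y ]      ≡⟨ cong (λ L → L₁ ++ a ∷ L) (sym (++-assoc N ds [ y ])) ⟩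
    L₁ ++ a ∷ (N ++ ds) ++ [ y ]    ≡⟨ sym (++-assoc L₁ (a ∷ N ++ ds) [ y ]) ⟩
    (L₁ ++ a ∷ N ++ ds) ++ [ y ]    ≡⟨ cong (_++ [ y ]) eq′ ⟩
    headOr a L₁ ∷ Z′ ++ [ y ]       ≡⟨ cong (λ w → arc w Z′ y) (sym (∷≡++⇒headOr L₁ eq)) ⟩
    arc x Z′ y                      ∎)
    where open ≡-Reasoning

  ∈-replace⁻ : ∀ (L₁ : List Vertex) {a N b L₂ M z} → z L.∈ L₁ ++ a ∷ N ++ b ∷ L₂ → z L.∈ N ⊎ z L.∈ L₁ ++ a ∷ M ++ b ∷ L₂
  ∈-replace⁻ L₁ {a} {N} {b} {L₂} {M} z∈ with ∈-++⁻ L₁ z∈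
  ... | inj₁ k           = inj₂ (∈-++⁺ˡ k)
  ... | inj₂ (here refl) = inj₂ (∈-++⁺ʳ L₁ (here refl))
  ... | inj₂ (there k) with ∈-++⁻ N k
  ...   | inj₁ k′ = inj₁ k′
  ...   | inj₂ k′ = inj₂ (∈-++⁺ʳ L₁ (there (∈-++⁺ʳ M k′)))

  OnList-chord : ∀ {e p q g} → Joins e p q → OnList (arc p [] q) g ⇔ g ≡ e
  OnList-chord je = mk⇔ (λ { (inj₁ j) → Joins-injective j je }) λ { refl → inj₁ je }

  -- S Δ R and R Δ T are the two cycles into which the chord e splits σ.
  record ChordDetour (u v : Vertex) (σ : EdgeSet) (e : Edge) (S T : List Vertex) : Set where
    field
      R      : List Vertex
      p q    : Vertex
      Fm Bm  : List Vertex
      split  : SplitByChord σ e p q Fm Bm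
      first  : Move (WithChord (arc p Fm q) e) u v S R
      second : Move (WithChord (arc q Bm p) e) u v R T

  ChordDetour-sym : ∀ {u v σ e S T} → ChordDetour u v σ e T S → ChordDetour u v σ e S T
  ChordDetour-sym d = record
    { split = SplitByChord-swap split ; first = Move-sym second ; second = Move-sym first }
    where open ChordDetour d

  module Detour {u v σ} P {x Sin y Tin} Q
    (pS : UVPath u v (P ++ x ∷ Sin ++ y ∷ Q)) (pT : UVPath u v (P ++ x ∷ Tin ++ y ∷ Q))
    (Sin#Tin : ∀ z → z L.∈ Sin → z L.∉ Tin)
    (σ⊆ : ∀ {g} → g ∈ σ → OnList (arc x Sin y) g ⊎ OnList (arc x Tin y) g) where

    S T : List Vertex
    S = P ++ x ∷ Sin ++ y ∷ Q
    T = P ++ x ∷ Tin ++ y ∷ Q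

    Tin#S : Disjoint Tin S
    Tin#S (k , i) = Sin#Tin _ (∈-frame P (proj₂ pT) k i) k

    Tin#arc : Disjoint Tin (arc x Sin y)
    Tin#arc (k , i) = Tin#S (k , arc⊆ P i)

    uniqueTin : Unique Tin
    uniqueTin = proj₁ (Unique-++⁻ Tin (Unique-tail (Unique-arc P (proj₂ pT))))

    uniqueCycle : Unique (x ∷ Sin ++ y ∷ reverse Tin)
    uniqueCycle = Unique-joinArcs (Unique-arc P (proj₂ pS)) uniqueTin Tin#arc

    σ⊆cycle : ∀ {g} → g ∈ σ → OnList (x ∷ Sin ++ y ∷ reverse Tin ++ [ x ]) g
    σ⊆cycle = Equivalence.from (OnList-joinArcs x Sin y Tin x) ∘ σ⊆

    module OnSide {e} L₁ {p} M {q} L₂ (je : Joins e p q) (X≡ : arc x Sin y ≡ L₁ ++ p ∷ M ++ q ∷ L₂) where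

      Bm : List Vertex
      Bm = (L₂ ++ reverse Tin) ++ L₁

      split : SplitByChord σ e p q M Bm
      split = SplitByChord-rotation L₁ (L₂ ++ reverse Tin) je
        (subst Unique (arc-reframe L₁ M L₂ X≡ (reverse Tin)) uniqueCycle)
        (λ {g} gσ → subst (λ L → OnList L g) (joinArcs-rotation L₁ M L₂ Tin X≡) (σ⊆cycle gσ))

      R : List Vertex
      R = (P ++ L₁) ++ p ∷ q ∷ (L₂ ++ Q)

      S≡ : S ≡ (P ++ L₁) ++ p ∷ M ++ q ∷ (L₂ ++ Q)
      S≡ = trans (cong (P ++_) (arc-reframe L₁ M L₂ X≡ Q)) (sym (++-assoc P L₁ _))

      pR : UVPath u v R
      pR = UVPath-replace (P ++ L₁) [] (subst (UVPath u v) S≡ pS) ((e , je) , tt) [] λ ()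

      first : Move (WithChord (arc p M q) e) u v S R
      first = pS , pR , P ++ L₁ , L₂ ++ Q , p , q , M , [] , S≡ , refl , (λ _ _ ()) ,
              λ g → ⇔-refl ⊎-⇔ ⇔-sym (OnList-chord je)

      Rin : List Vertex
      Rin = proj₁ (arc-replace L₁ L₂ X≡ [])

      R-arc : L₁ ++ p ∷ q ∷ L₂ ≡ arc x Rin y
      R-arc = proj₂ (arc-replace L₁ L₂ X≡ [])

      R≡ : R ≡ P ++ x ∷ Rin ++ y ∷ Q
      R≡ = trans (++-assoc P L₁ _) (cong (P ++_) (sym (arc-reframe L₁ [] L₂ (sym R-arc) Q)))

      Rin#Tin : ∀ z → z L.∈ Rin → z L.∉ Tin
      Rin#Tin z i k with ∈-replace⁻ L₁ {N = []} {M = M} (subst (z L.∈_) (sym R-arc) (there (∈-++⁺ˡ i)))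
      ... | inj₁ ()
      ... | inj₂ i′ = Tin#arc (k , subst (z L.∈_) (sym X≡) i′)

      second : Move (WithChord (arc q Bm p) e) u v R T
      second = pR , pT , P , Q , x , y , Rin , Tin , R≡ , refl , Rin#Tin , λ g → begin
        WithChord (arc q Bm p) e g
          ≈⟨ mk⇔ swap swap ⟩
        (g ≡ e ⊎ OnList (arc q Bm p) g)
          ≈⟨ ⇔-sym (OnList-chord je) ⊎-⇔ ⇔-refl ⟩
        (OnList (arc p [] q) g ⊎ OnList (arc q Bm p) g)
          ≈⟨ ⇔-sym (OnList-rotation L₁ p [] q (L₂ ++ reverse Tin)) ⟩
        OnList (L₁ ++ p ∷ q ∷ (L₂ ++ reverse Tin) ++ [ headOr p L₁ ]) g
          ≡⟨ cong (λ L → OnList L g) (sym (joinArcs-rotation L₁ [] L₂ Tin (sym R-arc))) ⟩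
        OnList (x ∷ Rin ++ y ∷ reverse Tin ++ [ x ]) g
          ≈⟨ OnList-joinArcs x Rin y Tin x ⟩
        (OnList (arc x Rin y) g ⊎ OnList (arc x Tin y) g) ∎
        where open SetoidReasoning (⇔-setoid 0ℓ)

      detour : ChordDetour u v σ e S T
      detour = record { split = split ; first = first ; second = second }

  module Across {u v σ e} P {x} S₁ {p} S₂ {y} T₁ {q} T₂ Q
    (pS : UVPath u v (P ++ x ∷ (S₁ ++ p ∷ S₂) ++ y ∷ Q)) (pT : UVPath u v (P ++ x ∷ (T₁ ++ q ∷ T₂) ++ y ∷ Q))
    (Sin#Tin : ∀ z → z L.∈ S₁ ++ p ∷ S₂ → z L.∉ T₁ ++ q ∷ T₂)
    (σ⊆ : ∀ {g} → g ∈ σ → OnList (arc x (S₁ ++ p ∷ S₂) y) g ⊎ OnList (arc x (T₁ ++ q ∷ T₂) y) g)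
    (je : Joins e p q) where

    open Detour P Q pS pT Sin#Tin σ⊆ using (S; T; Tin#S; uniqueTin; uniqueCycle; σ⊆cycle)

    M Bm : List Vertex
    M  = S₂ ++ y ∷ reverse T₂
    Bm = reverse T₁ ++ x ∷ S₁

    cycle≡ : x ∷ (S₁ ++ p ∷ S₂) ++ y ∷ reverse (T₁ ++ q ∷ T₂) ≡ (x ∷ S₁) ++ p ∷ M ++ q ∷ reverse T₁
    cycle≡ = cong (x ∷_) (begin
      (S₁ ++ p ∷ S₂) ++ y ∷ reverse (T₁ ++ q ∷ T₂)  ≡⟨ ++-assoc S₁ (p ∷ S₂) _ ⟩
      S₁ ++ p ∷ S₂ ++ y ∷ reverse (T₁ ++ q ∷ T₂)    ≡⟨ cong (λ L → S₁ ++ p ∷ S₂ ++ y ∷ L) reverse-Tin ⟩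
      S₁ ++ p ∷ S₂ ++ y ∷ reverse T₂ ++ q ∷ reverse T₁ ≡⟨ cong (λ L → S₁ ++ p ∷ L) (sym (++-assoc S₂ (y ∷ reverse T₂) _)) ⟩
      S₁ ++ p ∷ M ++ q ∷ reverse T₁                 ∎)
      where
      open ≡-Reasoning
      reverse-Tin : reverse (T₁ ++ q ∷ T₂) ≡ reverse T₂ ++ q ∷ reverse T₁
      reverse-Tin = trans (reverse-++ T₁ (q ∷ T₂))
        (trans (cong (_++ reverse T₁) (unfold-reverse q T₂)) (++-assoc (reverse T₂) [ q ] (reverse T₁)))

    split : SplitByChord σ e p q M Bm
    split = SplitByChord-rotation (x ∷ S₁) (reverse T₁) je (subst Unique cycle≡ uniqueCycle)
      λ {g} gσ → subst (λ L → OnList L g) walk≡ (σ⊆cycle gσ)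
      where
      walk≡ : x ∷ (S₁ ++ p ∷ S₂) ++ y ∷ reverse (T₁ ++ q ∷ T₂) ++ [ x ] ≡ (x ∷ S₁) ++ p ∷ M ++ q ∷ reverse T₁ ++ [ x ]
      walk≡ = trans (cong (x ∷_) (sym (++-assoc (S₁ ++ p ∷ S₂) (y ∷ reverse (T₁ ++ q ∷ T₂)) [ x ])))
                (trans (cong (_++ [ x ]) cycle≡) (++-assoc-segment (x ∷ S₁) p M q (reverse T₁) [ x ]))

    S≡ : S ≡ (P ++ x ∷ S₁) ++ p ∷ S₂ ++ y ∷ Q
    S≡ = trans (cong (λ L → P ++ x ∷ L) (++-assoc S₁ (p ∷ S₂) (y ∷ Q))) (sym (++-assoc P (x ∷ S₁) _))

    T≡ : T ≡ (P ++ x ∷ T₁) ++ q ∷ T₂ ++ y ∷ Q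
    T≡ = trans (cong (λ L → P ++ x ∷ L) (++-assoc T₁ (q ∷ T₂) (y ∷ Q))) (sym (++-assoc P (x ∷ T₁) _))

    R : List Vertex
    R = (P ++ x ∷ S₁) ++ p ∷ (q ∷ T₂) ++ y ∷ Q

    pR : UVPath u v R
    pR = UVPath-replace (P ++ x ∷ S₁) (q ∷ T₂) (subst (UVPath u v) S≡ pS)
      ((e , je) , Chain-arc (P ++ x ∷ T₁) (subst Chain T≡ (proj₁ (proj₁ pT))))
      (proj₁ (proj₂ (Unique-++⁻ T₁ uniqueTin)))
      λ (i , k) → Tin#S (∈-++⁺ʳ T₁ i , subst (_ L.∈_) (sym S≡) k)

    first : Move (WithChord (arc p M q) e) u v S R
    first = pS , pR , P ++ x ∷ S₁ , Q , p , y , S₂ , q ∷ T₂ , S≡ , refl ,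
            (λ z i k → Sin#Tin z (∈-++⁺ʳ S₁ (there i)) (∈-++⁺ʳ T₁ k)) , λ g → mk⇔ to from
      where
      arcs : ∀ {g} → OnList (arc p M q) g ⇔ (OnList (arc p S₂ y) g ⊎ OnList (arc q T₂ y) g)
      arcs {g} = ⇔-trans (mk⇔ (subst (λ L → OnList (p ∷ L) g) (++-assoc S₂ _ [ q ]))
                               (subst (λ L → OnList (p ∷ L) g) (sym (++-assoc S₂ _ [ q ]))))
                         (OnList-joinArcs p S₂ y T₂ q)
      to : ∀ {g} → WithChord (arc p M q) e g → OnList (arc p S₂ y) g ⊎ OnList (arc p (q ∷ T₂) y) g
      to (inj₁ o) with Equivalence.to arcs o
      ... | inj₁ o′ = inj₁ o′
      ... | inj₂ o′ = inj₂ (inj₂ o′)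
      to (inj₂ refl) = inj₂ (inj₁ je)
      from : ∀ {g} → OnList (arc p S₂ y) g ⊎ OnList (arc p (q ∷ T₂) y) g → WithChord (arc p M q) e g
      from (inj₁ o)        = inj₁ (Equivalence.from arcs (inj₁ o))
      from (inj₂ (inj₁ j)) = inj₂ (Joins-injective j je)
      from (inj₂ (inj₂ o)) = inj₁ (Equivalence.from arcs (inj₂ o))

    second : Move (WithChord (arc q Bm p) e) u v R T
    second = pR , pT , P , T₂ ++ y ∷ Q , x , q , S₁ ++ [ p ] , T₁ , R≡ ,
             cong (λ L → P ++ x ∷ L) (++-assoc T₁ (q ∷ T₂) (y ∷ Q)) , S₁p#T₁ , λ g → mk⇔ to from
      where
      R≡ : R ≡ P ++ x ∷ (S₁ ++ [ p ]) ++ q ∷ (T₂ ++ y ∷ Q)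
      R≡ = trans (++-assoc P (x ∷ S₁) _) (cong (λ L → P ++ x ∷ L) (sym (++-assoc S₁ [ p ] _)))
      S₁p#T₁ : ∀ z → z L.∈ S₁ ++ [ p ] → z L.∉ T₁
      S₁p#T₁ z i k with ∈-++⁻ S₁ i
      ... | inj₁ i′        = Sin#Tin z (∈-++⁺ˡ i′) (∈-++⁺ˡ k)
      ... | inj₂ (here refl) = Sin#Tin z (∈-++⁺ʳ S₁ (here refl)) (∈-++⁺ˡ k)
      back : ∀ {g} → OnList (arc q Bm p) g ⇔ (OnList (arc x T₁ q) g ⊎ OnList (arc x S₁ p) g)
      back {g} = ⇔-trans (mk⇔ (subst (λ L → OnList (q ∷ L) g) (++-assoc (reverse T₁) _ [ p ]))
                               (subst (λ L → OnList (q ∷ L) g) (sym (++-assoc (reverse T₁) _ [ p ]))))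
                         (⇔-trans (OnList-concatArcs q (reverse T₁) x S₁ p) (⇔-sym (OnList-arc-reverse x T₁ q) ⊎-⇔ ⇔-refl))
      forth : ∀ {g} → OnList (arc x (S₁ ++ [ p ]) q) g ⇔ (OnList (arc x S₁ p) g ⊎ OnList (arc p [] q) g)
      forth {g} = ⇔-trans (mk⇔ (subst (λ L → OnList (x ∷ L) g) (++-assoc S₁ [ p ] [ q ]))
                                (subst (λ L → OnList (x ∷ L) g) (sym (++-assoc S₁ [ p ] [ q ]))))
                          (OnList-concatArcs x S₁ p [] q)
      to : ∀ {g} → WithChord (arc q Bm p) e g → OnList (arc x (S₁ ++ [ p ]) q) g ⊎ OnList (arc x T₁ q) g
      to (inj₂ refl) = inj₁ (Equivalence.from forth (inj₂ (inj₁ je)))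
      to (inj₁ o) with Equivalence.to back o
      ... | inj₁ o′ = inj₂ o′
      ... | inj₂ o′ = inj₁ (Equivalence.from forth (inj₁ o′))
      from : ∀ {g} → OnList (arc x (S₁ ++ [ p ]) q) g ⊎ OnList (arc x T₁ q) g → WithChord (arc q Bm p) e g
      from (inj₂ o) = inj₁ (Equivalence.from back (inj₁ o))
      from (inj₁ o) with Equivalence.to forth o
      ... | inj₁ o′        = inj₁ (Equivalence.from back (inj₂ o′))
      ... | inj₂ (inj₁ j) = inj₂ (Joins-injective j je)

    detour : ChordDetour u v σ e S T
    detour = record { split = split ; first = first ; second = second }

  Ordered : List Vertex → Vertex → Vertex → Set
  Ordered L a b = ∃ λ L₁ → ∃ λ M → ∃ λ L₂ → L ≡ L₁ ++ a ∷ M ++ b ∷ L₂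

  ∈-ordered : ∀ L {a b} → a L.∈ L → b L.∈ L → a ≢ b → Ordered L a b ⊎ Ordered L b a
  ∈-ordered (z ∷ L) (here refl) (here refl) a≢b = ⊥-elim (a≢b refl)
  ∈-ordered (z ∷ L) (here refl) (there j)   _ with ∈-∃++ j
  ... | M , L₂ , refl = inj₁ ([] , M , L₂ , refl)
  ∈-ordered (z ∷ L) (there i)   (here refl) _ with ∈-∃++ i
  ... | M , L₂ , refl = inj₂ ([] , M , L₂ , refl)
  ∈-ordered (z ∷ L) (there i)   (there j)   a≢b with ∈-ordered L i j a≢b
  ... | inj₁ (L₁ , M , L₂ , eq) = inj₁ (z ∷ L₁ , M , L₂ , cong (z ∷_) eq)
  ... | inj₂ (L₁ , M , L₂ , eq) = inj₂ (z ∷ L₁ , M , L₂ , cong (z ∷_) eq)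

  ∈-arc-inner : ∀ {z x y : Vertex} {Z W} → z L.∈ arc x Z y → z L.∉ arc x W y → z L.∈ Z
  ∈-arc-inner (here refl) z∉ = ⊥-elim (z∉ (here refl))
  ∈-arc-inner {Z = Z} {W} (there i) z∉ with ∈-++⁻ Z i
  ... | inj₁ k         = k
  ... | inj₂ (here refl) = ⊥-elim (z∉ (there (∈-++⁺ʳ W (here refl))))

  chordDetour : ∀ {u v σ e} P {x Sin y Tin} Q →
    (pS : UVPath u v (P ++ x ∷ Sin ++ y ∷ Q)) (pT : UVPath u v (P ++ x ∷ Tin ++ y ∷ Q)) →
    (Sin#Tin : ∀ z → z L.∈ Sin → z L.∉ Tin) →
    (σ⊆ : ∀ {g} → g ∈ σ → OnList (arc x Sin y) g ⊎ OnList (arc x Tin y) g) →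
    ∀ {p q} → Joins e p q →
    p L.∈ arc x Sin y ⊎ p L.∈ arc x Tin y → q L.∈ arc x Sin y ⊎ q L.∈ arc x Tin y →
    ChordDetour u v σ e (P ++ x ∷ Sin ++ y ∷ Q) (P ++ x ∷ Tin ++ y ∷ Q)
  chordDetour P {x} {Sin} {y} {Tin} Q pS pT Sin#Tin σ⊆ {p} {q} je p∈ q∈ =
    cases (p ∈? arc x Sin y) (q ∈? arc x Sin y) (p ∈? arc x Tin y) (q ∈? arc x Tin y)
    where
    module S→T = Detour P Q pS pT Sin#Tin σ⊆
    module T→S = Detour P Q pT pS (λ z i k → Sin#Tin z k i) (swap ∘ σ⊆)
    p≢q = Joins⇒≢ je
    onS : p L.∈ arc x Sin y → q L.∈ arc x Sin y → ChordDetour _ _ _ _ _ _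
    onS p∈X q∈X with ∈-ordered (arc x Sin y) p∈X q∈X p≢q
    ... | inj₁ (L₁ , M , L₂ , eq) = S→T.OnSide.detour L₁ M L₂ je eq
    ... | inj₂ (L₁ , M , L₂ , eq) = S→T.OnSide.detour L₁ M L₂ (Joins-sym je) eq
    onT : p L.∈ arc x Tin y → q L.∈ arc x Tin y → ChordDetour _ _ _ _ _ _
    onT p∈Y q∈Y with ∈-ordered (arc x Tin y) p∈Y q∈Y p≢q
    ... | inj₁ (L₁ , M , L₂ , eq) = ChordDetour-sym (T→S.OnSide.detour L₁ M L₂ je eq)
    ... | inj₂ (L₁ , M , L₂ , eq) = ChordDetour-sym (T→S.OnSide.detour L₁ M L₂ (Joins-sym je) eq)
    across : ∀ {a b} → Joins _ a b → a L.∈ Sin → b L.∈ Tin → ChordDetour _ _ _ _ _ _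
    across jab a∈ b∈ with ∈-∃++ a∈ | ∈-∃++ b∈
    ... | S₁ , S₂ , refl | T₁ , T₂ , refl = Across.detour P S₁ S₂ T₁ T₂ Q pS pT Sin#Tin σ⊆ jab
    orElse : ∀ {A B : Set} → A ⊎ B → ¬ A → B
    orElse (inj₁ a) ¬a = ⊥-elim (¬a a)
    orElse (inj₂ b) _  = b
    cases : Dec (p L.∈ arc x Sin y) → Dec (q L.∈ arc x Sin y) → Dec (p L.∈ arc x Tin y) → Dec (q L.∈ arc x Tin y) →
      ChordDetour _ _ _ _ _ _
    cases (yes p∈X) (yes q∈X) _        _        = onS p∈X q∈X
    cases _        _        (yes p∈Y) (yes q∈Y) = onT p∈Y q∈Y
    cases (yes p∈X) (no q∉X)  (yes p∈Y) (no q∉Y)  = ⊥-elim (q∉Y (orElse q∈ q∉X))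
    cases (yes p∈X) (no q∉X)  (no p∉Y)  _        = across je (∈-arc-inner p∈X p∉Y) (∈-arc-inner (orElse q∈ q∉X) q∉X)
    cases (no p∉X)  _        (yes p∈Y) (no q∉Y)  =
      across (Joins-sym je) (∈-arc-inner (orElse (swap q∈) q∉Y) q∉Y) (∈-arc-inner p∈Y p∉X)
    cases (no p∉X)  _        (no p∉Y)  _        = ⊥-elim (p∉Y (orElse p∈ p∉X))

  -- Property Δ*

  ⊆∪⁅⁆⇒ : ∀ {γ σ : EdgeSet} {e} → γ ⊆ (σ ∪ ⁅ e ⁆) → ∀ {g} → g ∈ γ → g ≡ e ⊎ g ∈ σ
  ⊆∪⁅⁆⇒ {σ = σ} {e} γ⊆ gγ with x∈p∪q⁻ σ ⁅ e ⁆ (γ⊆ gγ)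
  ... | inj₁ gσ = inj₂ gσ
  ... | inj₂ g∈ = inj₁ (x∈⁅y⁆⇒x≡y e g∈)

  chord∈cycle : ∀ {D : EdgeSet → Set} {σ γ e} → IsCycle σ → ¬ D σ → IsCycle γ → D γ → γ ⊆ (σ ∪ ⁅ e ⁆) → e ∈ γ
  chord∈cycle {σ = σ} {γ} {e} cσ σ∉D cγ γ∈D γ⊆ with e ∈ₛ? γ
  ... | yes e∈γ = e∈γ
  ... | no  e∉γ = ⊥-elim (σ∉D (subst _ (sym (cycle-⊆-cycle cσ cγ γ⊆σ)) γ∈D))
    where
    γ⊆σ : γ ⊆ σ
    γ⊆σ gγ with ⊆∪⁅⁆⇒ γ⊆ gγ
    ... | inj₁ refl = ⊥-elim (e∉γ gγ)
    ... | inj₂ gσ   = gσ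

  -- Take U = σ in Δ*: the new edge e is a chord of σ, and α, β are the two
  -- halves of σ closed by e.
  Δ*-detour : ∀ {D σ u v} → (∀ c → D c → IsCycle c) → IsCycle σ → ¬ D σ → PropΔ* D σ →
    ∀ {S T} → AdjP (_≡ σ) u v S T → Star (AdjP D u v) S T
  Δ*-detour {D} {σ} D⊆cycles cσ σ∉D Δσ (pS , pT , P , Q , x , y , Sin , Tin , refl , refl , Sin#Tin , _ , refl , σ⇔)
    with Δσ σ (IsCycle⇒Unicycle cσ) (λ g∈ → g∈)
  ... | e , _ , α , β , α∈D , β∈D , α⊆ , β⊆ , σ≡αΔβ = viaHalves (chordDetour P Q pS pT Sin#Tin σ⊆ je (endOnσ (Joins⇒Incidentˡ je)) (endOnσ (Joins⇒Incidentʳ je)))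
    where
    cα = D⊆cycles α α∈D
    cβ = D⊆cycles β β∈D
    eα = chord∈cycle cσ σ∉D cα α∈D α⊆
    eβ = chord∈cycle cσ σ∉D cβ β∈D β⊆
    σ⊆ : ∀ {g} → g ∈ σ → OnList (arc x Sin y) g ⊎ OnList (arc x Tin y) g
    σ⊆ {g} = Equivalence.to (σ⇔ g)
    σαβ : ∀ {g} → g ∈ σ → g ∈ α → g ∉ β
    σαβ gσ = ∈-Δ⇒∉ (subst (_ ∈_) σ≡αΔβ gσ)
    endOnσ : ∀ {w} → Incident e w → w L.∈ arc x Sin y ⊎ w L.∈ arc x Tin y
    endOnσ i with IsCycle⇒MinDegree₂ cα e _ eα i
    ... | g , gα , g≢e , i′ with ⊆∪⁅⁆⇒ α⊆ gα
    ...   | inj₁ g≡e = ⊥-elim (g≢e g≡e)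
    ...   | inj₂ gσ  = ⊎-map (λ o → OnList⇒∈ _ o i′) (λ o → OnList⇒∈ _ o i′) (σ⊆ gσ)
    je : Joins e (proj₁ (ends e)) (proj₂ (ends e))
    je = inj₁ refl
    viaHalves : ChordDetour _ _ σ e _ _ → Star (AdjP D _ _) _ _
    viaHalves d with chord-splits-cycle (ChordDetour.split d) (IsCycle⇒MinDegree₂ cα) (IsCycle⇒MinDegree₂ cβ) eα eβ
                           (⊆∪⁅⁆⇒ α⊆) (⊆∪⁅⁆⇒ β⊆) σαβ
    ... | inj₁ (αF , βB) = Move⇒AdjP α∈D αF (ChordDetour.first d) ◅ Move⇒AdjP β∈D βB (ChordDetour.second d) ◅ ε
    ... | inj₂ (αB , βF) = Move⇒AdjP β∈D βF (ChordDetour.first d) ◅ Move⇒AdjP α∈D αB (ChordDetour.second d) ◅ ε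

  AdjP-map : ∀ {D D′ : EdgeSet → Set} {u v S T} → (∀ {c} → D c → D′ c) → AdjP D u v S T → AdjP D′ u v S T
  AdjP-map f (pS , pT , P , Q , x , y , Sin , Tin , eS , eT , dj , c , Dc , iso) =
    pS , pT , P , Q , x , y , Sin , Tin , eS , eT , dj , c , f Dc , iso

  AdjP-⊎ : ∀ {D A B : EdgeSet → Set} {u v S T} → (∀ {c} → D c → A c ⊎ B c) →
    AdjP D u v S T → AdjP A u v S T ⊎ AdjP B u v S T
  AdjP-⊎ f (pS , pT , P , Q , x , y , Sin , Tin , eS , eT , dj , c , Dc , iso) with f Dc
  ... | inj₁ Ac = inj₁ (pS , pT , P , Q , x , y , Sin , Tin , eS , eT , dj , c , Ac , iso)
  ... | inj₂ Bc = inj₂ (pS , pT , P , Q , x , y , Sin , Tin , eS , eT , dj , c , Bc , iso)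

  Ext-∷⁻ : ∀ {𝒞 σ σs c} → Ext 𝒞 (σ ∷ σs) c → c ≡ σ ⊎ Ext 𝒞 σs c
  Ext-∷⁻ (inj₁ c∈𝒞)       = inj₂ (inj₁ c∈𝒞)
  Ext-∷⁻ (inj₂ (here c≡σ)) = inj₁ c≡σ
  Ext-∷⁻ (inj₂ (there c∈)) = inj₂ (inj₂ c∈)

  Ext-cycles : ∀ {𝒞 σs} → (∀ c → 𝒞 c → IsCycle c) → ClosureRun 𝒞 σs → ∀ c → Ext 𝒞 σs c → IsCycle c
  Ext-cycles 𝒞⊆ run c (inj₁ c∈𝒞) = 𝒞⊆ c c∈𝒞
  Ext-cycles 𝒞⊆ (add run cσ _ _) c (inj₂ (here refl)) = cσ
  Ext-cycles 𝒞⊆ (add run _ _ _)  c (inj₂ (there c∈)) = Ext-cycles 𝒞⊆ run c (inj₂ c∈)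

  AdjP-closure : ∀ {𝒞 σs u v} → (∀ c → 𝒞 c → IsCycle c) → ClosureRun 𝒞 σs →
    ∀ {S T} → AdjP (Ext 𝒞 σs) u v S T → Star (AdjP 𝒞 u v) S T
  AdjP-closure 𝒞⊆ start adj = AdjP-map (λ { (inj₁ c∈𝒞) → c∈𝒞 }) adj ◅ ε
  AdjP-closure {𝒞} 𝒞⊆ (add run cσ σ∉ Δσ) adj with AdjP-⊎ (Ext-∷⁻ {𝒞}) adj
  ... | inj₁ adjσ = (AdjP-closure 𝒞⊆ run ⋆) (Δ*-detour (Ext-cycles 𝒞⊆ run) cσ σ∉ Δσ adjσ)
  ... | inj₂ adj′ = AdjP-closure 𝒞⊆ run adj′

  -- The full path graph is connected

  length-joinArcs : ∀ (Z : List Vertex) y W → ¬ (Z ≡ [] × W ≡ []) → 2 ≤ length (Z ++ y ∷ reverse W)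
  length-joinArcs (_ ∷ [])    y W _ = s≤s (s≤s z≤n)
  length-joinArcs (_ ∷ _ ∷ _) y W _ = s≤s (s≤s z≤n)
  length-joinArcs []          y []      nonTrivial = ⊥-elim (nonTrivial (refl , refl))
  length-joinArcs []          y (w ∷ W) _ = s≤s (subst (1 ≤_) (sym (length-reverse (w ∷ W))) (s≤s z≤n))

  AdjP-detour : ∀ {D u v} → (∀ c → IsCycle c → D c) → ∀ P {x Z y Q W} →
    UVPath u v (P ++ x ∷ Z ++ y ∷ Q) → Chain (arc x W y) → Unique W → Disjoint W (P ++ x ∷ Z ++ y ∷ Q) →
    ¬ (Z ≡ [] × W ≡ []) → AdjP D u v (P ++ x ∷ Z ++ y ∷ Q) (P ++ x ∷ W ++ y ∷ Q)
  AdjP-detour cycles⊆D P {x} {Z} {y} {Q} {W} pS chW uW W#S nonTrivial =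
    pS , UVPath-replace P W pS chW uW W#S , P , Q , x , y , Z , W , refl , refl ,
    (λ z i k → W#S (k , arc⊆ P (there (∈-++⁺ˡ i)))) , edgeSetOf walk , cycles⊆D _ cycle , onCycle
    where
    walk = x ∷ (Z ++ y ∷ reverse W) ++ [ x ]
    walk≡ : walk ≡ x ∷ Z ++ y ∷ reverse W ++ [ x ]
    walk≡ = cong (x ∷_) (++-assoc Z (y ∷ reverse W) [ x ])
    chain : Chain walk
    chain = subst Chain (sym walk≡) (Chain-++⁺ (x ∷ Z) (Chain-arc P (proj₁ (proj₁ pS)))
              (subst Chain (reverse-arc x W y) (Chain-reverse (arc x W y) chW)))
    cycle : IsCycle (edgeSetOf walk)
    cycle = x , Z ++ y ∷ reverse W , length-joinArcs Z y W nonTrivial ,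
            Unique-joinArcs (Unique-arc P (proj₂ pS)) uW (λ (k , i) → W#S (k , arc⊆ P i)) ,
            chain , EdgesOf-edgeSetOf walk
    onCycle : ∀ g → (g ∈ edgeSetOf walk) ⇔ (OnList (arc x Z y) g ⊎ OnList (arc x W y) g)
    onCycle g = ⇔-trans (EdgesOf-edgeSetOf walk g)
                  (⇔-trans (mk⇔ (subst (λ L → OnList L g) walk≡) (subst (λ L → OnList L g) (sym walk≡)))
                           (OnList-joinArcs x Z y W x))

  firstCommon : ∀ (S L : List Vertex) {z} → z L.∈ L → z L.∈ S →
    ∃ λ W → ∃ λ y → ∃ λ Q → L ≡ W ++ y ∷ Q × Disjoint W S × y L.∈ S
  firstCommon S (w ∷ L) z∈L z∈S with w ∈? S
  ... | yes w∈S = [] , w , L , refl , (λ ()) , w∈S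
  ... | no  w∉S with z∈L
  ...   | here refl = ⊥-elim (w∉S z∈S)
  ...   | there z∈L′ with firstCommon S L z∈L′ z∈S
  ...     | W , y , Q , refl , W#S , y∈S = w ∷ W , y , Q , refl , w∷W#S , y∈S
    where
    w∷W#S : Disjoint (w ∷ W) S
    w∷W#S (here refl , w∈S) = w∉S w∈S
    w∷W#S (there k , k′)    = W#S (k , k′)

  last-∈ : ∀ (L : List Vertex) {z} → last L ≡ just z → z L.∈ L
  last-∈ (x ∷ [])    refl = here refl
  last-∈ (x ∷ y ∷ L) eq   = there (last-∈ (y ∷ L) eq)

  UVPath-last∈ : ∀ {u v} P {x L} → UVPath u v (P ++ x ∷ L) → v L.∈ x ∷ L
  UVPath-last∈ P ((_ , _ , l) , _) = last-∈ _ (trans (sym (last-++ P)) l)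

  UVPath-end : ∀ {u v} P {x t T′} → UVPath u v (P ++ x ∷ []) → ¬ UVPath u v (P ++ x ∷ t ∷ T′)
  UVPath-end P {x} {t} {T′} pS pT with UVPath-last∈ P pS
  ... | here refl = Unique[x∷xs]⇒x∉xs (proj₁ (proj₂ (Unique-++⁻ P (proj₂ pT))))
                      (UVPath-last∈ (P ++ [ x ]) (subst (UVPath _ _) (sym (++-assoc P [ x ] (t ∷ T′))) pT))

  -- Where two uv-paths first part after a common prefix, follow T until it
  -- meets S again; the segments in between form a cycle.
  diverge : ∀ {u v} P {x s S′ t T′} → UVPath u v (P ++ x ∷ s ∷ S′) → UVPath u v (P ++ x ∷ t ∷ T′) → s ≢ t →
    ∃ λ Z → ∃ λ y → ∃ λ Q → ∃ λ W → ∃ λ Q′ → s ∷ S′ ≡ Z ++ y ∷ Q × t ∷ T′ ≡ W ++ y ∷ Q′ ×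
      Disjoint W (P ++ x ∷ s ∷ S′) × ¬ (Z ≡ [] × W ≡ [])
  diverge P {x} {s} {S′} {t} {T′} pS pT s≢t
    with firstCommon (P ++ x ∷ s ∷ S′) (t ∷ T′) (tail-last∈ pT) (∈-++⁺ʳ P (UVPath-last∈ P pS))
    where
    tail-last∈ : UVPath _ _ (P ++ x ∷ t ∷ T′) → _ L.∈ t ∷ T′
    tail-last∈ p = UVPath-last∈ (P ++ [ x ]) (subst (UVPath _ _) (sym (++-assoc P [ x ] (t ∷ T′))) p)
  ... | W , y , Q′ , T≡ , W#S , y∈S with ∈-∃++ (y∈s∷S′ y∈S)
    where
    y∈T′ : y L.∈ t ∷ T′
    y∈T′ = subst (y L.∈_) (sym T≡) (∈-++⁺ʳ W (here refl))
    parts = Unique-++⁻ P (proj₂ pT)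
    y∈s∷S′ : y L.∈ P ++ x ∷ s ∷ S′ → y L.∈ s ∷ S′
    y∈s∷S′ i with ∈-++⁻ P i
    ... | inj₁ y∈P         = ⊥-elim (proj₂ (proj₂ parts) (y∈P , there y∈T′))
    ... | inj₂ (here refl) = ⊥-elim (Unique[x∷xs]⇒x∉xs (proj₁ (proj₂ parts)) y∈T′)
    ... | inj₂ (there i′)  = i′
  ...   | Z , Q , S≡ = Z , y , Q , W , Q′ , S≡ , T≡ , W#S , λ (Z≡[] , W≡[]) → s≢t (trans (s≡y Z≡[]) (sym (t≡y W≡[])))
    where
    s≡y : Z ≡ [] → s ≡ y
    s≡y refl = ∷-injectiveˡ S≡
    t≡y : W ≡ [] → t ≡ y
    t≡y refl = ∷-injectiveˡ T≡

  module _ {D : EdgeSet → Set} (cycles⊆D : ∀ c → IsCycle c → D c) {u v : Vertex} where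

    connect : ∀ k P x S′ T′ → UVPath u v (P ++ x ∷ S′) → UVPath u v (P ++ x ∷ T′) → length T′ ≤ k →
      Star (AdjP D u v) (P ++ x ∷ S′) (P ++ x ∷ T′)
    connectAfter : ∀ k P x W y L L′ → UVPath u v (P ++ x ∷ W ++ y ∷ L) → UVPath u v (P ++ x ∷ W ++ y ∷ L′) →
      length L′ ≤ k → Star (AdjP D u v) (P ++ x ∷ W ++ y ∷ L) (P ++ x ∷ W ++ y ∷ L′)

    connect k       P x []       []       _  _  _ = ε
    connect k       P x []       (t ∷ T′) pS pT _ = ⊥-elim (UVPath-end P pS pT)
    connect k       P x (s ∷ S′) []       pS pT _ = ⊥-elim (UVPath-end P pT pS)
    connect zero    P x (s ∷ S′) (t ∷ T′) _  _  ()
    connect (suc k) P x (s ∷ S′) (t ∷ T′) pS pT (s≤s len) with s ≟ t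
    ... | yes refl = connectAfter k P x [] s S′ T′ pS pT len
    ... | no s≢t with diverge P pS pT s≢t
    ...   | Z , y , Q , W , Q′ , S≡ , T≡ , W#S , nonTrivial =
      subst₂ (Star (AdjP D u v)) (cong (λ L → P ++ x ∷ L) (sym S≡)) (cong (λ L → P ++ x ∷ L) (sym T≡))
        (AdjP-detour cycles⊆D P pS′ (Chain-arc P (proj₁ (proj₁ pT′))) uniqueW W#S′ nonTrivial ◅
         connectAfter k P x W y Q Q′ (UVPath-replace P W pS′ (Chain-arc P (proj₁ (proj₁ pT′))) uniqueW W#S′) pT′ len′)
      where
      pS′ = subst (λ L → UVPath u v (P ++ x ∷ L)) S≡ pS
      pT′ = subst (λ L → UVPath u v (P ++ x ∷ L)) T≡ pT
      W#S′ = subst (λ L → Disjoint W (P ++ x ∷ L)) S≡ W#S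
      uniqueW = proj₁ (Unique-++⁻ W (Unique-tail (Unique-arc P (proj₂ pT′))))
      len′ : length Q′ ≤ k
      len′ = ≤-pred (≤-trans (length-++-≤ʳ (y ∷ Q′) {W}) (≤-trans (≤-reflexive (cong length (sym T≡))) (s≤s len)))

    connectAfter k P x W y L L′ pL pL′ len =
      subst₂ (Star (AdjP D u v)) (++-assoc P (x ∷ W) (y ∷ L)) (++-assoc P (x ∷ W) (y ∷ L′))
        (connect k (P ++ x ∷ W) y L L′ (subst (UVPath u v) (sym (++-assoc P (x ∷ W) (y ∷ L))) pL)
                                       (subst (UVPath u v) (sym (++-assoc P (x ∷ W) (y ∷ L′))) pL′) len)

    PathGraph-connected : ∀ S T → UVPath u v S → UVPath u v T → Star (AdjP D u v) S T
    PathGraph-connected []       _        ((_ , () , _) , _) _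
    PathGraph-connected (s ∷ S′) []       _ ((_ , () , _) , _)
    PathGraph-connected (s ∷ S′) (t ∷ T′) pS@((_ , refl , _) , _) pT@((_ , refl , _) , _) =
      connect (length T′) [] s S′ T′ pS pT ≤-refl

-- The argument never uses that G is 2-connected.
theorem5 : (G : Graph) → Graph.TwoConnected G →
    (u v : Fin (Graph.n G)) →
    (𝒞 : Subset (Graph.m G) → Set) →
    (∀ c → 𝒞 c → Graph.IsCycle G c) →
    Graph.Δ*-Dense G 𝒞 →
    Graph.PathGraphConnected G 𝒞 u v
theorem5 G _ u v 𝒞 𝒞-cycles (σs , run , cycles⊆Cl) S T pS pT =
  (AdjP-closure 𝒞-cycles run ⋆) (PathGraph-connected cycles⊆Cl S T pS pT)
  where open PathGraph G
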